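{- Let $n\ge2$. The $n$-gonal poset $G_n$ is retractable to the 2-chain by a retraction by a $(Q,2)$-symmetry where $Q$ is an $(n-1)$-fence, followed, if $n$ is even, by a retraction by the singleton-symmetry (i.e. the $(Q',2)$-symmetry with $Q'$ the one-element poset).
   Context: An $m$-fence is a poset with elements $a_1,\dots,a_m$ whose only strict relations are alternating relations between consecutive elements ($a_1<a_2>a_3<\cdots$ or $a_1>a_2<a_3>\cdots$). The $n$-gonal poset $G_n$ has $2n$ elements $a_1,\dots,a_{2n}$ with $a_1<a_2>a_3<\cdots<a_{2n}>a_1$ (cyclically alternating covering relations) and no other strict relations. For a poset $X$, $\ell(X)$ is the maximal cardinality of a chain. A subset $A$ of $X$ is maximally ordered in $X$ if $|\{(a,b)\in A\times A:a<b\}|$ is maximal among subsets of $X$ of cardinality $|A|$. For $\sigma\in\mathrm{Aut}(P)$, $\Sigma(\sigma)=\{p:\sigma(p)\ne p\}$. For a finite poset $Q$ and $r\ge2$, $\sigma$ is a $(Q,r)$-generator if there are subsets $S_0,\dots,S_{r-1}\subset\Sigma(\sigma)$, each isomorphic to $Q$, which are the smallest maximally ordered subsets of $\Sigma(\sigma)$ with $\sigma(S_i)=S_{i+1\bmod r}$, $\ell(S_i)=\ell(\Sigma(\sigma))$, $\bigcup_iS_i=\Sigma(\sigma)$. Elements $a,b$ are $(Q,r,1)$-symmetric if for such $\sigma$, $a\in S_i$ and $b=\sigma^q(a)$, $1\le q<r$; $(Q,r)$-symmetry is the generated equivalence relation, and the retraction $P\oslash_rQ$ is the quotient poset ($A\le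 B$ iff $a\le b$ for some $a\in A,b\in B$). Retractable to $R$ means some finite sequence of nontrivial retractions yields $R$. -}

module Defs where

open import Data.Bool using (Bool; true; false; _∧_; _∨_; not; if_then_else_)
open import Data.Nat using (ℕ; zero; suc; _+_; _*_; _∸_; _≤_; _<_; _≡ᵇ_; _%_)
open import Data.Nat.DivMod using (m%n<n)
open import Data.Fin using (Fin; toℕ; fromℕ<; _≟_)
open import Data.Fin.Subset using (Subset; _∈_; _⊆_; ∣_∣)
open import Data.Fin.Permutation using (Permutation′; _⟨$⟩ʳ_; _⟨$⟩ˡ_)
open import Data.Vec using (lookup; tabulate)
open import Data.List using (List; map; allFin)
open import Data.Nat.ListAction using (sum)
open import Data.Bool.ListAction using (any)
open import Data.Product using (Σ; Σ-syntax; ∃; ∃-syntax; _×_; _,_)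
open import Data.Sum using (_⊎_)
open import Function.Definitions using (Injective; Surjective)
open import Relation.Nullary.Decidable using (⌊_⌋)
open import Relation.Binary.PropositionalEquality using (_≡_)
open import Relation.Binary.Construct.Closure.Equivalence using (EqClosure)

-- Finite posets: carrier Fin k, decidable (Boolean) non-strict order ≤.

FinOrd : ℕ → Set
FinOrd k = Fin k → Fin k → Bool

lt : ∀ {k} → FinOrd k → Fin k → Fin k → Bool
lt P a b = P a b ∧ not ⌊ a ≟ b ⌋

isEven : ℕ → Bool
isEven n = n % 2 ≡ᵇ 0

-- m-fence with elements a_1..a_m (as Fin m, a_{i+1} = i).
-- up = true : a_1 < a_2 > a_3 < ... ; up = false : a_1 > a_2 < a_3 > ...
-- position i is a minimum iff (toℕ i even) == up.
fenceMin : ∀ {m} → Bool → Fin m → Bool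
fenceMin true  i = isEven (toℕ i)
fenceMin false i = not (isEven (toℕ i))

fence : (m : ℕ) → Bool → FinOrd m
fence m up i j =
  ⌊ i ≟ j ⌋ ∨ (fenceMin up i ∧ ((suc (toℕ i) ≡ᵇ toℕ j) ∨ (suc (toℕ j) ≡ᵇ toℕ i)))

point : FinOrd 1
point _ _ = true

chain2 : FinOrd 2
chain2 i j = ⌊ toℕ i Data.Nat.≤? toℕ j ⌋

-- n-gonal poset G_n on Fin (2 * n), a_{i+1} = i:
-- a_1 < a_2 > a_3 < ... < a_{2n} > a_1 ; even positions (0-based) are minima.
cycAdj : (n : ℕ) → ℕ → ℕ → Bool
cycAdj n i j = (suc i ≡ᵇ j) ∨ (suc j ≡ᵇ i) ∨ ((i ≡ᵇ 0) ∧ (suc j ≡ᵇ 2 * n)) ∨ ((j ≡ᵇ 0) ∧ (suc i ≡ᵇ 2 * n))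

gon : (n : ℕ) → FinOrd (2 * n)
gon n i j = ⌊ i ≟ j ⌋ ∨ (isEven (toℕ i) ∧ cycAdj n (toℕ i) (toℕ j))

IsAut : ∀ {k} → FinOrd k → Permutation′ k → Set
IsAut P σ = ∀ a b → P (σ ⟨$⟩ʳ a) (σ ⟨$⟩ʳ b) ≡ P a b

support : ∀ {k} → Permutation′ k → Subset k
support σ = tabulate (λ p → not ⌊ σ ⟨$⟩ʳ p ≟ p ⌋)

image : ∀ {k} → Permutation′ k → Subset k → Subset k
image σ S = tabulate (λ q → lookup S (σ ⟨$⟩ˡ q))

iter : ∀ {A : Set} → ℕ → (A → A) → A → A
iter zero    f x = x
iter (suc q) f x = f (iter q f x)

b2n : Bool → ℕ
b2n true  = 1
b2n false = 0

ordCount : ∀ {k} → FinOrd k → Subset k → ℕ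
ordCount {k} P A =
  sum (map (λ a → sum (map (λ b → b2n (lookup A a ∧ lookup A b ∧ lt P a b)) (allFin k))) (allFin k))

MaxOrdered : ∀ {k} → FinOrd k → Subset k → Subset k → Set
MaxOrdered P X A = A ⊆ X × (∀ B → B ⊆ X → ∣ B ∣ ≡ ∣ A ∣ → ordCount P B ≤ ordCount P A)

IsChain : ∀ {k} → FinOrd k → Subset k → Set
IsChain P C = ∀ a b → a ∈ C → b ∈ C → (P a b ≡ true ⊎ P b a ≡ true)

Height : ∀ {k} → FinOrd k → Subset k → ℕ → Set
Height P S h =
  (∃[ C ] (C ⊆ S × IsChain P C × ∣ C ∣ ≡ h)) ×
  (∀ C → C ⊆ S → IsChain P C → ∣ C ∣ ≤ h)

SubIso : ∀ {k m} → FinOrd k → Subset k → FinOrd m → Set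
SubIso {k} {m} P S Q =
  Σ[ e ∈ (Fin m → Fin k) ]
    (Injective _≡_ _≡_ e × (∀ i → e i ∈ S) × (∀ p → p ∈ S → ∃[ i ] e i ≡ p) ×
     (∀ i j → P (e i) (e j) ≡ Q i j))

next : ∀ {r} → Fin r → Fin r
next {suc r} i = fromℕ< (m%n<n (suc (toℕ i)) (suc r))

Admissible : ∀ {k} → FinOrd k → Permutation′ k → (r : ℕ) → (Fin r → Subset k) → Set
Admissible P σ r S =
  (∀ i → MaxOrdered P (support σ) (S i)) ×
  (∀ i → image σ (S i) ≡ S (next i)) ×
  (∀ i → ∃[ h ] (Height P (S i) h × Height P (support σ) h)) ×
  (∀ p → p ∈ support σ → ∃[ i ] p ∈ S i)

GeneratorFamily : ∀ {k m} → FinOrd k → FinOrd m → (r : ℕ) → Permutation′ k → (Fin r → Subset k) → Set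
GeneratorFamily {k} P Q r σ S =
  IsAut P σ × 2 ≤ r × Admissible P σ r S × (∀ i → SubIso P (S i) Q) ×
  (∀ (T : Fin r → Subset k) → Admissible P σ r T → ∀ i j → ∣ S i ∣ ≤ ∣ T j ∣)

Sym1 : ∀ {k m} → FinOrd k → FinOrd m → ℕ → Fin k → Fin k → Set
Sym1 {k} P Q r a b =
  Σ[ σ ∈ Permutation′ k ] Σ[ S ∈ (Fin r → Subset k) ]
    (GeneratorFamily P Q r σ S × (∃[ i ] a ∈ S i) ×
     (∃[ q ] (1 ≤ q × q < r × b ≡ iter q (σ ⟨$⟩ʳ_) a)))

Sym : ∀ {k m} → FinOrd k → FinOrd m → ℕ → Fin k → Fin k → Set
Sym P Q r = EqClosure (Sym1 P Q r)

-- Retraction P ⊘_r Q, presented by a quotient map f : Fin k → Fin k'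
-- whose fibres are exactly the (Q,r)-symmetry classes; the order on
-- Fin k' is the induced one: A ≤ B iff a ≤ b for some a ∈ A, b ∈ B.

IsRetractionMap : ∀ {k m k'} → FinOrd k → FinOrd m → ℕ → (Fin k → Fin k') → Set
IsRetractionMap P Q r f =
  Surjective _≡_ _≡_ f × (∀ a b → (f a ≡ f b → Sym P Q r a b) × (Sym P Q r a b → f a ≡ f b))

induced : ∀ {k k'} → FinOrd k → (Fin k → Fin k') → FinOrd k'
induced {k} P f u v =
  any (λ a → any (λ b → ⌊ f a ≟ u ⌋ ∧ ⌊ f b ≟ v ⌋ ∧ P a b) (allFin k)) (allFin k)

OrdIso : ∀ {k m} → FinOrd k → FinOrd m → Set
OrdIso {k} {m} P R =
  Σ[ g ∈ (Fin k → Fin m) ]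
    (Injective _≡_ _≡_ g × Surjective _≡_ _≡_ g × (∀ u v → R (g u) (g v) ≡ P u v))

{-# OPTIONS --safe #-}
-- The reflection x ↦ −x of the 2n-cycle G_n (n ≥ 3) is a (fence (n − 1), 2)-generator: it swaps
-- {1, …, n − 1} and {n + 1, …, 2n − 1}, which are maximally ordered fences of the right height, and
-- no admissible family has smaller sets. Conjugating it by the rotation by two gives the generator
-- x ↦ 4 − x; together they make x symmetric to x + 4 and 1 to 3, and for odd n also 0 to 2, as
-- 2n − 2 ≡ 0 (mod 4). Conversely automorphisms preserve parity, and for even n ≥ 4 every generator
-- fixes an even point (its two fences hold only n − 2 minima) and therefore preserves residues mod 4
-- of even points. So the symmetry classes are the two parities for odd n, with quotient the
-- 2-chain, and {0 mod 4}, {2 mod 4}, odd for even n, with quotient Λ, whose two minimal points are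
-- exchanged by a transposition. For n = 2 the generators are transpositions and the classes are the
-- parities again.

module Submission where

open import Data.Bool using (Bool; true; false; _∧_; _∨_; not; if_then_else_)
import Data.Bool
open import Data.Bool.ListAction using (any; or)
open import Data.Bool.Properties using (not-involutive; not-injective; ∨-comm; ∨-zeroʳ; ∨-identityʳ; ∧-zeroʳ; ∧-identityʳ)
open import Data.Empty using (⊥; ⊥-elim)
open import Data.Fin using (Fin; zero; suc; toℕ; fromℕ<; opposite; _≟_)
open import Data.Fin.Permutation using (Permutation′; _⟨$⟩ʳ_; _⟨$⟩ˡ_; inverseˡ; inverseʳ; flip; transpose; permutation)
open import Data.Fin.Properties using (toℕ-injective; toℕ<n; toℕ-fromℕ<; opposite-prop; opposite-involutive; suc-injective; 0≢1+n; all?; any?)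
open import Data.Fin.Subset using (Subset; _∈_; _∉_; _⊆_; ∣_∣; ⁅_⁆; _∪_; _∩_; ∁; Nonempty; Empty)
open import Data.Fin.Subset.Properties
  using (Empty-unique; ∣⊥∣≡0; ∣⁅x⁆∣≡1; p⊆q⇒∣p∣≤∣q∣; p⊂q⇒∣p∣<∣q∣; p∩q⊆p; x∈⁅x⁆; x∈⁅y⁆⇒x≡y; x∈p∩q⁺; x∈p∩q⁻; x∈p∪q⁺; x∈p∪q⁻;
         x∉p⇒x∈∁p; x∈∁p⇒x∉p; nonempty?; _∈?_)
import Data.List as List
open import Data.List using (map; allFin)
open import Data.List.Properties using (map-tabulate; map-cong)
open import Data.Nat using (ℕ; zero; suc; _+_; _*_; _∸_; _≤_; _<_; z≤n; s≤s; NonZero; _≡ᵇ_; _%_)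
import Data.Nat.Properties as ℕ
open import Data.Nat.Properties
  using (+-suc; +-comm; +-identityʳ; +-cancelʳ-≡; +-mono-≤; +-mono-<; m≤m+n; n≤1+n; m∸n+n≡m;
         ≤-refl; ≤-trans; ≤-reflexive; ≤-antisym; ≤-pred; ≮⇒≥; ≰⇒>; <-≤-trans; <-irrefl; <-cmp; _<?_; module ≤-Reasoning)
open import Algebra.Properties.CommutativeMonoid.Sum ℕ.+-0-commutativeMonoid using (sum-syntax; sum-permute; ∑-distrib-+)
  renaming (sum to ∑)
open import Algebra.Properties.CommutativeSemigroup ℕ.+-commutativeSemigroup using (x∙yz≈y∙xz)
open import Data.Nat.DivMod using ([m+kn]%n≡m%n)
open import Data.Nat.ListAction using (sum)
open import Data.Nat.Solver using (module +-*-Solver)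
open import Data.Product using (Σ-syntax; ∃-syntax; _×_; _,_; proj₁; proj₂)
open import Data.Sum using (_⊎_; inj₁; inj₂)
open import Data.Vec using (Vec; []; _∷_; lookup; tabulate)
open import Data.Vec.Properties using (lookup∘tabulate; tabulate∘lookup; tabulate-cong; lookup-zipWith; []=⇒lookup; lookup⇒[]=)
open import Function using (_∘_; id)
open import Function.Definitions using (Injective)
open import Function.Consequences.Propositional using (strictlySurjective⇒surjective)
open import Level using (Level)
open import Relation.Nullary using (¬_; Dec; yes; no)
open import Relation.Nullary.Decidable using (⌊_⌋; dec-true; dec-false; _×-dec_; from-yes)
open import Relation.Binary using (Rel; IsEquivalence)
open import Relation.Binary.Definitions using (Tri; tri<; tri≈; tri>)
open import Relation.Binary.PropositionalEquality using (_≡_; _≢_; refl; sym; trans; cong; cong₂; subst; subst₂; module ≡-Reasoning)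
import Relation.Binary.PropositionalEquality.Properties as ≡
open import Relation.Binary.Construct.Closure.Equivalence using (return; reflexive; symmetric; transitive; isEquivalence; gfold)
import Relation.Binary.Construct.Closure.Equivalence as EqClosure
open import Defs

true≢false : true ≢ false
true≢false ()

∨-true⁻ : ∀ {x y : Bool} → x ∨ y ≡ true → x ≡ true ⊎ y ≡ true
∨-true⁻ {true}  _ = inj₁ refl
∨-true⁻ {false} e = inj₂ e

∧-true⁻ : ∀ {x y : Bool} → x ∧ y ≡ true → x ≡ true × y ≡ true
∧-true⁻ {true} {true} _ = refl , refl

∨-trueˡ : ∀ {x} (y : Bool) → x ≡ true → x ∨ y ≡ true
∨-trueˡ _ refl = refl

∨-trueʳ : ∀ (x : Bool) {y} → y ≡ true → x ∨ y ≡ true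
∨-trueʳ true  _ = refl
∨-trueʳ false e = e

bool-ext : ∀ {x y : Bool} → (x ≡ true → y ≡ true) → (y ≡ true → x ≡ true) → x ≡ y
bool-ext {false} {false} _ _ = refl
bool-ext {false} {true} _ y⇒x = y⇒x refl
bool-ext {true} x⇒y _ = sym (x⇒y refl)

≡ᵇ-true⁻ : ∀ {m n} → (m ≡ᵇ n) ≡ true → m ≡ n
≡ᵇ-true⁻ {m} {n} eq = ℕ.≡ᵇ⇒≡ m n (subst Data.Bool.T (sym eq) _)

≡ᵇ-true⁺ : ∀ {m n} → m ≡ n → (m ≡ᵇ n) ≡ true
≡ᵇ-true⁺ {zero} refl = refl
≡ᵇ-true⁺ {suc m} refl = ≡ᵇ-true⁺ {m} refl

⌊⌋-true⁺ : ∀ {P : Set} (d : Dec P) → P → ⌊ d ⌋ ≡ true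
⌊⌋-true⁺ (yes _) _ = refl
⌊⌋-true⁺ (no ¬p) p = ⊥-elim (¬p p)

⌊⌋-true⁻ : ∀ {P : Set} (d : Dec P) → ⌊ d ⌋ ≡ true → P
⌊⌋-true⁻ (yes p) _ = p

⌊⌋-false⁺ : ∀ {P : Set} (d : Dec P) → ¬ P → ⌊ d ⌋ ≡ false
⌊⌋-false⁺ (yes p) ¬p = ⊥-elim (¬p p)
⌊⌋-false⁺ (no _) _ = refl

≟-refl : ∀ {k} (x : Fin k) → ⌊ x ≟ x ⌋ ≡ true
≟-refl x = ⌊⌋-true⁺ (x ≟ x) refl

≟-≢ : ∀ {k} {x y : Fin k} → x ≢ y → ⌊ x ≟ y ⌋ ≡ false
≟-≢ {x = x} {y} = ⌊⌋-false⁺ (x ≟ y)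

≟-true⁻ : ∀ {k} {x y : Fin k} → ⌊ x ≟ y ⌋ ≡ true → x ≡ y
≟-true⁻ {x = x} {y} = ⌊⌋-true⁻ (x ≟ y)

≟-sym : ∀ {k} (x y : Fin k) → ⌊ x ≟ y ⌋ ≡ ⌊ y ≟ x ⌋
≟-sym x y with x ≟ y | y ≟ x
... | yes _ | yes _ = refl
... | yes x≡y | no y≢x = ⊥-elim (y≢x (sym x≡y))
... | no x≢y | yes y≡x = ⊥-elim (x≢y (sym y≡x))
... | no _ | no _ = refl

≟-injective : ∀ {k m} (f : Fin k → Fin m) → Injective _≡_ _≡_ f → ∀ x y → ⌊ f x ≟ f y ⌋ ≡ ⌊ x ≟ y ⌋
≟-injective f inj x y with x ≟ y | f x ≟ f y
... | yes _   | yes _    = refl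
... | yes x≡y | no fx≢fy = ⊥-elim (fx≢fy (cong f x≡y))
... | no x≢y  | yes fx≡fy = ⊥-elim (x≢y (inj fx≡fy))
... | no _    | no _     = refl

sum-map-allFin : ∀ {k} (f : Fin k → ℕ) → sum (map f (allFin k)) ≡ ∑[ i < k ] f i
sum-map-allFin f = trans (cong sum (map-tabulate (λ i → i) f)) (sum-tabulate f)
  where
  sum-tabulate : ∀ {k} (f : Fin k → ℕ) → sum (List.tabulate f) ≡ ∑[ i < k ] f i
  sum-tabulate {zero} f = refl
  sum-tabulate {suc k} f = cong (f zero +_) (sum-tabulate (f ∘ suc))

∑-cong : ∀ {k} {f g : Fin k → ℕ} → (∀ i → f i ≡ g i) → ∑[ i < k ] f i ≡ ∑[ i < k ] g i
∑-cong {zero} _ = refl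
∑-cong {suc k} f≡g = cong₂ _+_ (f≡g zero) (∑-cong (f≡g ∘ suc))

∑-zero : ∀ {k} (f : Fin k → ℕ) → (∀ i → f i ≡ 0) → ∑[ i < k ] f i ≡ 0
∑-zero {zero} _ _ = refl
∑-zero {suc k} f f≡0 = cong₂ _+_ (f≡0 zero) (∑-zero (f ∘ suc) (f≡0 ∘ suc))

zeroAt : ∀ {k} → Fin k → (Fin k → ℕ) → Fin k → ℕ
zeroAt i f j with j ≟ i
... | yes _ = 0
... | no _ = f j

∑-zeroAt : ∀ {k} (f : Fin k → ℕ) (i : Fin k) → ∑[ j < k ] f j ≡ f i + ∑[ j < k ] zeroAt i f j
∑-zeroAt f zero = refl
∑-zeroAt {suc k} f (suc i) = begin
  f zero + ∑[ j < k ] f (suc j)                         ≡⟨ cong (f zero +_) (∑-zeroAt (f ∘ suc) i) ⟩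
  f zero + (f (suc i) + ∑[ j < k ] zeroAt i (f ∘ suc) j) ≡⟨ x∙yz≈y∙xz (f zero) (f (suc i)) _ ⟩
  f (suc i) + (f zero + ∑[ j < k ] zeroAt i (f ∘ suc) j) ≡⟨ cong (λ s → f (suc i) + (f zero + s)) (∑-cong zeroAt-suc) ⟩
  f (suc i) + ∑[ j < suc k ] zeroAt (suc i) f j          ∎
  where
  open ≡-Reasoning
  zeroAt-suc : ∀ j → zeroAt i (f ∘ suc) j ≡ zeroAt (suc i) f (suc j)
  zeroAt-suc j with j ≟ i
  ... | yes _ = refl
  ... | no _ = refl

∑-single : ∀ {k} (f : Fin k → ℕ) (i : Fin k) → (∀ j → j ≢ i → f j ≡ 0) → ∑[ j < k ] f j ≡ f i
∑-single f i rest = trans (∑-zeroAt f i) (trans (cong (f i +_) (∑-zero _ vanishes)) (+-identityʳ (f i)))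
  where
  vanishes : ∀ j → zeroAt i f j ≡ 0
  vanishes j with j ≟ i
  ... | yes _ = refl
  ... | no j≢i = rest j j≢i

∑-reindex-injective : ∀ {m k} (e : Fin m → Fin k) → Injective _≡_ _≡_ e → (f : Fin k → ℕ) →
  (∀ p → f p ≢ 0 → ∃[ i ] e i ≡ p) → ∑[ p < k ] f p ≡ ∑[ i < m ] f (e i)
∑-reindex-injective {zero} e _ f covered = ∑-zero f vanish
  where
  vanish : ∀ p → f p ≡ 0
  vanish p with f p ℕ.≟ 0
  ... | yes fp≡0 = fp≡0
  ... | no fp≢0 with covered p fp≢0
  ... | () , _
∑-reindex-injective {suc m} e inj f covered = begin
  ∑[ p < _ ] f p                                 ≡⟨ ∑-zeroAt f (e zero) ⟩
  f (e zero) + ∑[ p < _ ] f′ p                   ≡⟨ cong (f (e zero) +_) (∑-reindex-injective (e ∘ suc) (suc-injective ∘ inj) f′ covered′) ⟩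
  f (e zero) + ∑[ i < m ] f′ (e (suc i))         ≡⟨ cong (f (e zero) +_) (∑-cong unaffected) ⟩
  f (e zero) + ∑[ i < m ] f (e (suc i))          ∎
  where
  open ≡-Reasoning
  f′ = zeroAt (e zero) f
  covered′ : ∀ p → f′ p ≢ 0 → ∃[ i ] e (suc i) ≡ p
  covered′ p f′p≢0 with p ≟ e zero
  ... | yes _ = ⊥-elim (f′p≢0 refl)
  ... | no p≢e0 with covered p f′p≢0
  ... | zero , e0≡p = ⊥-elim (p≢e0 (sym e0≡p))
  ... | suc i , ei≡p = i , ei≡p
  unaffected : ∀ i → f′ (e (suc i)) ≡ f (e (suc i))
  unaffected i with e (suc i) ≟ e zero
  ... | yes ei≡e0 with inj ei≡e0
  ... | ()
  unaffected i | no _ = refl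

∣p∣≡∑ : ∀ {k} (p : Subset k) → ∣ p ∣ ≡ ∑[ x < k ] b2n (lookup p x)
∣p∣≡∑ [] = refl
∣p∣≡∑ (true ∷ p) = cong suc (∣p∣≡∑ p)
∣p∣≡∑ (false ∷ p) = ∣p∣≡∑ p

∣p∪q∣+∣p∩q∣≡∣p∣+∣q∣ : ∀ {k} (p q : Subset k) → ∣ p ∪ q ∣ + ∣ p ∩ q ∣ ≡ ∣ p ∣ + ∣ q ∣
∣p∪q∣+∣p∩q∣≡∣p∣+∣q∣ [] [] = refl
∣p∪q∣+∣p∩q∣≡∣p∣+∣q∣ (true ∷ p) (true ∷ q) =
  cong suc (trans (+-suc ∣ p ∪ q ∣ ∣ p ∩ q ∣) (trans (cong suc (∣p∪q∣+∣p∩q∣≡∣p∣+∣q∣ p q)) (sym (+-suc ∣ p ∣ ∣ q ∣))))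
∣p∪q∣+∣p∩q∣≡∣p∣+∣q∣ (true ∷ p) (false ∷ q) = cong suc (∣p∪q∣+∣p∩q∣≡∣p∣+∣q∣ p q)
∣p∪q∣+∣p∩q∣≡∣p∣+∣q∣ (false ∷ p) (true ∷ q) = trans (cong suc (∣p∪q∣+∣p∩q∣≡∣p∣+∣q∣ p q)) (sym (+-suc ∣ p ∣ ∣ q ∣))
∣p∪q∣+∣p∩q∣≡∣p∣+∣q∣ (false ∷ p) (false ∷ q) = ∣p∪q∣+∣p∩q∣≡∣p∣+∣q∣ p q

∣p∪q∣≤∣p∣+∣q∣ : ∀ {k} (p q : Subset k) → ∣ p ∪ q ∣ ≤ ∣ p ∣ + ∣ q ∣
∣p∪q∣≤∣p∣+∣q∣ p q = ≤-trans (m≤m+n ∣ p ∪ q ∣ ∣ p ∩ q ∣) (≤-reflexive (∣p∪q∣+∣p∩q∣≡∣p∣+∣q∣ p q))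

Empty⇒∣p∣≡0 : ∀ {k} {p : Subset k} → Empty p → ∣ p ∣ ≡ 0
Empty⇒∣p∣≡0 {k} empty = trans (cong ∣_∣ (Empty-unique empty)) (∣⊥∣≡0 k)

∣p∣+∣q∣≤∣p∪q∣ : ∀ {k} (p q : Subset k) → Empty (p ∩ q) → ∣ p ∣ + ∣ q ∣ ≤ ∣ p ∪ q ∣
∣p∣+∣q∣≤∣p∪q∣ p q disjoint = ≤-reflexive (begin
  ∣ p ∣ + ∣ q ∣             ≡⟨ sym (∣p∪q∣+∣p∩q∣≡∣p∣+∣q∣ p q) ⟩
  ∣ p ∪ q ∣ + ∣ p ∩ q ∣     ≡⟨ cong (∣ p ∪ q ∣ +_) (Empty⇒∣p∣≡0 disjoint) ⟩
  ∣ p ∪ q ∣ + 0             ≡⟨ +-identityʳ _ ⟩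
  ∣ p ∪ q ∣                 ∎)
  where open ≡-Reasoning

∣p∣≤1 : ∀ {k} (p : Subset k) → (∀ {x y} → x ∈ p → y ∈ p → x ≡ y) → ∣ p ∣ ≤ 1
∣p∣≤1 {k} p unique with nonempty? p
... | yes (x , x∈p) = ≤-trans (p⊆q⇒∣p∣≤∣q∣ p⊆⁅x⁆) (≤-reflexive (∣⁅x⁆∣≡1 x))
  where
  p⊆⁅x⁆ : p ⊆ ⁅ x ⁆
  p⊆⁅x⁆ y∈p = subst (_∈ ⁅ x ⁆) (unique x∈p y∈p) (x∈⁅x⁆ x)
... | no empty = ≤-trans (≤-reflexive (Empty⇒∣p∣≡0 empty)) z≤n

∣⁅x⁆∪⁅y⁆∣≡2 : ∀ {k} {x y : Fin k} → x ≢ y → ∣ ⁅ x ⁆ ∪ ⁅ y ⁆ ∣ ≡ 2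
∣⁅x⁆∪⁅y⁆∣≡2 {x = x} {y} x≢y = ℕ.≤-antisym
  (≤-trans (∣p∪q∣≤∣p∣+∣q∣ ⁅ x ⁆ ⁅ y ⁆) (≤-reflexive (cong₂ _+_ (∣⁅x⁆∣≡1 x) (∣⁅x⁆∣≡1 y))))
  (≤-trans (≤-reflexive (sym (cong₂ _+_ (∣⁅x⁆∣≡1 x) (∣⁅x⁆∣≡1 y)))) (∣p∣+∣q∣≤∣p∪q∣ ⁅ x ⁆ ⁅ y ⁆ disjoint))
  where
  disjoint : Empty (⁅ x ⁆ ∩ ⁅ y ⁆)
  disjoint (z , z∈) with x∈p∩q⁻ ⁅ x ⁆ ⁅ y ⁆ z∈
  ... | z∈x , z∈y = x≢y (trans (sym (x∈⁅y⁆⇒x≡y x z∈x)) (x∈⁅y⁆⇒x≡y y z∈y))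

vec-ext : ∀ {A : Set} {k} {u v : Vec A k} → (∀ x → lookup u x ≡ lookup v x) → u ≡ v
vec-ext {u = u} {v} eq = trans (sym (tabulate∘lookup u)) (trans (tabulate-cong eq) (tabulate∘lookup v))

half-≤ : ∀ {a b} → a + a ≤ b + b → a ≤ b
half-≤ {a} {b} a+a≤b+b with a ℕ.≤? b
... | yes a≤b = a≤b
... | no a≰b = ⊥-elim (<-irrefl refl (<-≤-trans (+-mono-< (≰⇒> a≰b) (≰⇒> a≰b)) a+a≤b+b))

ordCount≡∑ : ∀ {k} (P : FinOrd k) (A : Subset k) →
  ordCount P A ≡ ∑[ a < k ] ∑[ b < k ] b2n (lookup A a ∧ lookup A b ∧ lt P a b)
ordCount≡∑ {k} P A = trans (sum-map-allFin row) (∑-cong (λ a → sum-map-allFin (term a)))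
  where
  term : Fin k → Fin k → ℕ
  term a b = b2n (lookup A a ∧ lookup A b ∧ lt P a b)
  row : Fin k → ℕ
  row a = sum (map (term a) (allFin k))

ordCount-antichain : ∀ {k} (P : FinOrd k) (A : Subset k) →
  (∀ {a b} → a ∈ A → b ∈ A → lt P a b ≡ false) → ordCount P A ≡ 0
ordCount-antichain P A incomparable = trans (ordCount≡∑ P A) (∑-zero _ λ a → ∑-zero _ (term a))
  where
  term : ∀ a b → b2n (lookup A a ∧ lookup A b ∧ lt P a b) ≡ 0
  term a b with lookup A a in a∈A | lookup A b in b∈A
  ... | false | _ = refl
  ... | true | false = refl
  ... | true | true rewrite incomparable (lookup⇒[]= a A a∈A) (lookup⇒[]= b A b∈A) = refl

pair-chain : ∀ {k} {P : FinOrd k} {a b : Fin k} → P a a ≡ true → P b b ≡ true → P a b ≡ true → IsChain P (⁅ a ⁆ ∪ ⁅ b ⁆)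
pair-chain {a = a} {b} Paa Pbb Pab x y x∈ y∈ with x∈p∪q⁻ ⁅ a ⁆ ⁅ b ⁆ x∈ | x∈p∪q⁻ ⁅ a ⁆ ⁅ b ⁆ y∈
... | inj₁ x∈a | inj₁ y∈a rewrite x∈⁅y⁆⇒x≡y a x∈a | x∈⁅y⁆⇒x≡y a y∈a = inj₁ Paa
... | inj₁ x∈a | inj₂ y∈b rewrite x∈⁅y⁆⇒x≡y a x∈a | x∈⁅y⁆⇒x≡y b y∈b = inj₁ Pab
... | inj₂ x∈b | inj₁ y∈a rewrite x∈⁅y⁆⇒x≡y b x∈b | x∈⁅y⁆⇒x≡y a y∈a = inj₂ Pab
... | inj₂ x∈b | inj₂ y∈b rewrite x∈⁅y⁆⇒x≡y b x∈b | x∈⁅y⁆⇒x≡y b y∈b = inj₁ Pbb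

lt⇒≤ : ∀ {k} (P : FinOrd k) a b → lt P a b ≡ true → P a b ≡ true
lt⇒≤ P a b a<b = proj₁ (∧-true⁻ {P a b} a<b)

module _ {k : ℕ} (π : Permutation′ k) where

  ⟨$⟩ʳ-injective : Injective _≡_ _≡_ (π ⟨$⟩ʳ_)
  ⟨$⟩ʳ-injective eq = trans (sym (inverseˡ π)) (trans (cong (π ⟨$⟩ˡ_) eq) (inverseˡ π))

  lookup-image : ∀ (S : Subset k) q → lookup (image π S) q ≡ lookup S (π ⟨$⟩ˡ q)
  lookup-image S q = lookup∘tabulate _ q

  ∈-image⁻ : ∀ {S q} → q ∈ image π S → π ⟨$⟩ˡ q ∈ S
  ∈-image⁻ {S} {q} q∈πS = lookup⇒[]= _ S (trans (sym (lookup-image S q)) ([]=⇒lookup q∈πS))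

  ∈-image⁺ : ∀ {S q} → π ⟨$⟩ˡ q ∈ S → q ∈ image π S
  ∈-image⁺ {S} {q} π⁻¹q∈S = lookup⇒[]= q (image π S) (trans (lookup-image S q) ([]=⇒lookup π⁻¹q∈S))

  ∈-image⁺′ : ∀ {S p} → p ∈ S → π ⟨$⟩ʳ p ∈ image π S
  ∈-image⁺′ {S} p∈S = ∈-image⁺ (subst (_∈ S) (sym (inverseˡ π)) p∈S)

  image-⊆ : ∀ {A B} → A ⊆ B → image π A ⊆ image π B
  image-⊆ A⊆B q∈πA = ∈-image⁺ (A⊆B (∈-image⁻ q∈πA))

  image-image-flip : ∀ B → image π (image (flip π) B) ≡ B
  image-image-flip B = vec-ext λ q → trans (lookup-image (image (flip π) B) q)
    (trans (lookup∘tabulate _ (π ⟨$⟩ˡ q)) (cong (lookup B) (inverseʳ π)))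

  ∣image∣ : ∀ S → ∣ image π S ∣ ≡ ∣ S ∣
  ∣image∣ S = begin
    ∣ image π S ∣                                  ≡⟨ ∣p∣≡∑ (image π S) ⟩
    ∑[ q < k ] b2n (lookup (image π S) q)          ≡⟨ ∑-cong (cong b2n ∘ lookup-image S) ⟩
    ∑[ q < k ] b2n (lookup S (π ⟨$⟩ˡ q))           ≡⟨ sym (sum-permute (b2n ∘ lookup S) (flip π)) ⟩
    ∑[ p < k ] b2n (lookup S p)                    ≡⟨ sym (∣p∣≡∑ S) ⟩
    ∣ S ∣                                          ∎
    where open ≡-Reasoning

module _ {k : ℕ} {P : FinOrd k} (π : Permutation′ k) (aut : IsAut P π) where

  aut-flip : IsAut P (flip π)
  aut-flip a b = trans (sym (aut (π ⟨$⟩ˡ a) (π ⟨$⟩ˡ b))) (cong₂ P (inverseʳ π) (inverseʳ π))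

  lt-aut : ∀ a b → lt P (π ⟨$⟩ʳ a) (π ⟨$⟩ʳ b) ≡ lt P a b
  lt-aut a b = cong₂ (λ u v → u ∧ not v) (aut a b) (≟-injective _ (⟨$⟩ʳ-injective π) a b)

  ordCount-image : ∀ B → ordCount P (image π B) ≡ ordCount P B
  ordCount-image B = begin
    ordCount P (image π B)                                            ≡⟨ ordCount≡∑ P (image π B) ⟩
    ∑[ a < k ] ∑[ b < k ] term (image π B) a b                         ≡⟨ sum-permute (λ a → ∑[ b < k ] term (image π B) a b) π ⟩
    ∑[ a < k ] ∑[ b < k ] term (image π B) (π ⟨$⟩ʳ a) b                ≡⟨ ∑-cong (λ a → sum-permute (term (image π B) (π ⟨$⟩ʳ a)) π) ⟩
    ∑[ a < k ] ∑[ b < k ] term (image π B) (π ⟨$⟩ʳ a) (π ⟨$⟩ʳ b)      ≡⟨ ∑-cong (λ a → ∑-cong (λ b → cong b2n (term-image a b))) ⟩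
    ∑[ a < k ] ∑[ b < k ] term B a b                                   ≡⟨ sym (ordCount≡∑ P B) ⟩
    ordCount P B                                                       ∎
    where
    open ≡-Reasoning
    term : Subset k → Fin k → Fin k → ℕ
    term A a b = b2n (lookup A a ∧ lookup A b ∧ lt P a b)
    lookup-image-π : ∀ a → lookup (image π B) (π ⟨$⟩ʳ a) ≡ lookup B a
    lookup-image-π a = trans (lookup-image π B (π ⟨$⟩ʳ a)) (cong (lookup B) (inverseˡ π))
    term-image : ∀ a b → (lookup (image π B) (π ⟨$⟩ʳ a) ∧ lookup (image π B) (π ⟨$⟩ʳ b) ∧ lt P (π ⟨$⟩ʳ a) (π ⟨$⟩ʳ b))
                       ≡ (lookup B a ∧ lookup B b ∧ lt P a b)
    term-image a b = cong₂ _∧_ (lookup-image-π a) (cong₂ _∧_ (lookup-image-π b) (lt-aut a b))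

  isChain-image : ∀ {C} → IsChain P C → IsChain P (image π C)
  isChain-image chain a b a∈ b∈ with chain (π ⟨$⟩ˡ a) (π ⟨$⟩ˡ b) (∈-image⁻ π a∈) (∈-image⁻ π b∈)
  ... | inj₁ a≤b = inj₁ (trans (sym (aut-flip a b)) a≤b)
  ... | inj₂ b≤a = inj₂ (trans (sym (aut-flip b a)) b≤a)

  subIso-image : ∀ {m} {S} {Q : FinOrd m} → SubIso P S Q → SubIso P (image π S) Q
  subIso-image {S = S} (e , e-inj , e∈S , e-onto , e-iso) =
    (π ⟨$⟩ʳ_) ∘ e , (λ eq → e-inj (⟨$⟩ʳ-injective π eq)) , (λ i → ∈-image⁺′ π (e∈S i)) , onto ,
    λ i j → trans (aut (e i) (e j)) (e-iso i j)
    where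
    onto : ∀ p → p ∈ image π S → ∃[ i ] π ⟨$⟩ʳ e i ≡ p
    onto p p∈ with e-onto (π ⟨$⟩ˡ p) (∈-image⁻ π p∈)
    ... | i , ei≡ = i , trans (cong (π ⟨$⟩ʳ_) ei≡) (inverseʳ π)

module _ {k : ℕ} {P : FinOrd k} (π : Permutation′ k) (aut : IsAut P π) where

  private
    preimage-⊆ : ∀ {B X} → B ⊆ image π X → image (flip π) B ⊆ X
    preimage-⊆ {X = X} B⊆πX q∈ = subst (_∈ X) (inverseˡ π) (∈-image⁻ π (B⊆πX (∈-image⁻ (flip π) q∈)))

  maxOrdered-image : ∀ {X A} → MaxOrdered P X A → MaxOrdered P (image π X) (image π A)
  maxOrdered-image {X} {A} (A⊆X , maximal) = image-⊆ π A⊆X , λ B B⊆πX ∣B∣≡ →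
    subst₂ _≤_ (trans (sym (ordCount-image π aut (image (flip π) B))) (cong (ordCount P) (image-image-flip π B)))
               (sym (ordCount-image π aut A))
               (maximal (image (flip π) B) (preimage-⊆ B⊆πX) (trans (∣image∣ (flip π) B) (trans ∣B∣≡ (∣image∣ π A))))

  height-image : ∀ {S h} → Height P S h → Height P (image π S) h
  height-image {S} {h} ((C , C⊆S , chain , ∣C∣≡h) , bound) =
    (image π C , image-⊆ π C⊆S , isChain-image π aut chain , trans (∣image∣ π C) ∣C∣≡h) ,
    λ C′ C′⊆πS chain′ → subst (_≤ h) (∣image∣ (flip π) C′)
                           (bound _ (preimage-⊆ C′⊆πS) (isChain-image (flip π) (aut-flip π aut) chain′))

module _ {k : ℕ} {P : FinOrd k} (τ σ σ′ : Permutation′ k) (autτ : IsAut P τ)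
         (comm : ∀ x → σ′ ⟨$⟩ʳ (τ ⟨$⟩ʳ x) ≡ τ ⟨$⟩ʳ (σ ⟨$⟩ʳ x)) where

  private
    conj : ∀ x → σ′ ⟨$⟩ʳ x ≡ τ ⟨$⟩ʳ (σ ⟨$⟩ʳ (τ ⟨$⟩ˡ x))
    conj x = trans (cong (σ′ ⟨$⟩ʳ_) (sym (inverseʳ τ))) (comm (τ ⟨$⟩ˡ x))

    conj⁻¹ : ∀ q → τ ⟨$⟩ˡ (σ′ ⟨$⟩ˡ q) ≡ σ ⟨$⟩ˡ (τ ⟨$⟩ˡ q)
    conj⁻¹ q = trans (cong (τ ⟨$⟩ˡ_) σ′⁻¹q≡) (inverseˡ τ)
      where
      σ′⁻¹q≡ : σ′ ⟨$⟩ˡ q ≡ τ ⟨$⟩ʳ (σ ⟨$⟩ˡ (τ ⟨$⟩ˡ q))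
      σ′⁻¹q≡ = trans (cong (σ′ ⟨$⟩ˡ_) (sym (trans (comm _) (trans (cong (τ ⟨$⟩ʳ_) (inverseʳ σ)) (inverseʳ τ))))) (inverseˡ σ′)

  isAut-conj : IsAut P σ → IsAut P σ′
  isAut-conj autσ a b = trans (cong₂ P (conj a) (conj b)) (trans (autτ _ _) (trans (autσ _ _) (aut-flip τ autτ a b)))

  support-conj : support σ′ ≡ image τ (support σ)
  support-conj = vec-ext λ p → begin
    lookup (support σ′) p                              ≡⟨ lookup∘tabulate _ p ⟩
    not ⌊ σ′ ⟨$⟩ʳ p ≟ p ⌋                              ≡⟨ cong₂ (λ u v → not ⌊ u ≟ v ⌋) (conj p) (sym (inverseʳ τ)) ⟩
    not ⌊ τ ⟨$⟩ʳ (σ ⟨$⟩ʳ (τ ⟨$⟩ˡ p)) ≟ τ ⟨$⟩ʳ (τ ⟨$⟩ˡ p) ⌋ ≡⟨ cong not (≟-injective _ (⟨$⟩ʳ-injective τ) _ _) ⟩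
    not ⌊ σ ⟨$⟩ʳ (τ ⟨$⟩ˡ p) ≟ τ ⟨$⟩ˡ p ⌋                ≡⟨ sym (lookup∘tabulate _ (τ ⟨$⟩ˡ p)) ⟩
    lookup (support σ) (τ ⟨$⟩ˡ p)                      ≡⟨ sym (lookup-image τ (support σ) p) ⟩
    lookup (image τ (support σ)) p                     ∎
    where open ≡-Reasoning

  image-conj : ∀ S → image σ′ (image τ S) ≡ image τ (image σ S)
  image-conj S = vec-ext λ q → trans (lookup-image σ′ (image τ S) q) (trans (lookup-image τ S _)
    (trans (cong (lookup S) (conj⁻¹ q)) (trans (sym (lookup-image σ S (τ ⟨$⟩ˡ q))) (sym (lookup-image τ (image σ S) q)))))

  admissible-conj : ∀ {r} {S : Fin r → Subset k} → Admissible P σ r S → Admissible P σ′ r (image τ ∘ S)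
  admissible-conj {S = S} (maximal , cyclic , height , cover) =
    (λ i → subst (λ X → MaxOrdered P X (image τ (S i))) (sym support-conj) (maxOrdered-image τ autτ (maximal i))) ,
    (λ i → trans (image-conj (S i)) (cong (image τ) (cyclic i))) ,
    (λ i → let (h , hS , hΣ) = height i in
           h , height-image τ autτ hS , subst (λ X → Height P X h) (sym support-conj) (height-image τ autτ hΣ)) ,
    λ p p∈ → let (i , q∈) = cover (τ ⟨$⟩ˡ p) (∈-image⁻ τ (subst (p ∈_) support-conj p∈)) in i , ∈-image⁺ τ q∈

generatorFamily-conj : ∀ {k m r} {P : FinOrd k} {Q : FinOrd m} {τ σ σ′ : Permutation′ k} {S : Fin r → Subset k} →
  IsAut P τ → (∀ x → σ′ ⟨$⟩ʳ (τ ⟨$⟩ʳ x) ≡ τ ⟨$⟩ʳ (σ ⟨$⟩ʳ x)) →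
  GeneratorFamily P Q r σ S → GeneratorFamily P Q r σ′ (image τ ∘ S)
generatorFamily-conj {τ = τ} {σ} {σ′} {S} autτ comm (autσ , 2≤r , adm , iso , minimal) =
  isAut-conj τ σ σ′ autτ comm autσ , 2≤r , admissible-conj τ σ σ′ autτ comm adm , subIso-image τ autτ ∘ iso ,
  λ T admT i j → subst₂ _≤_ (sym (∣image∣ τ (S i))) (∣image∣ (flip τ) (T j))
    (minimal (image (flip τ) ∘ T) (admissible-conj (flip τ) σ′ σ (aut-flip τ autτ) comm′ admT) i j)
  where
  comm′ : ∀ x → σ ⟨$⟩ʳ (τ ⟨$⟩ˡ x) ≡ τ ⟨$⟩ˡ (σ′ ⟨$⟩ʳ x)
  comm′ x = sym (trans (cong (τ ⟨$⟩ˡ_) (trans (cong (σ′ ⟨$⟩ʳ_) (sym (inverseʳ τ))) (comm (τ ⟨$⟩ˡ x)))) (inverseˡ τ))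

∈-support⁺ : ∀ {k} (σ : Permutation′ k) {p} → σ ⟨$⟩ʳ p ≢ p → p ∈ support σ
∈-support⁺ σ {p} σp≢p = lookup⇒[]= p (support σ) (trans (lookup∘tabulate _ p) (cong not (≟-≢ σp≢p)))

∈-support⁻ : ∀ {k} (σ : Permutation′ k) {p} → p ∈ support σ → σ ⟨$⟩ʳ p ≢ p
∈-support⁻ σ {p} p∈ σp≡p = true≢false (begin
  true                      ≡⟨ sym ([]=⇒lookup p∈) ⟩
  lookup (support σ) p      ≡⟨ lookup∘tabulate _ p ⟩
  not ⌊ σ ⟨$⟩ʳ p ≟ p ⌋      ≡⟨ cong (λ z → not ⌊ z ≟ p ⌋) σp≡p ⟩
  not ⌊ p ≟ p ⌋             ≡⟨ cong not (≟-refl p) ⟩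
  false                     ∎)
  where open ≡-Reasoning

iter-invariant : ∀ {A B : Set} (f : A → B) (g : A → A) → (∀ x → f (g x) ≡ f x) → ∀ q x → f (iter q g x) ≡ f x
iter-invariant f g invariant zero x = refl
iter-invariant f g invariant (suc q) x = trans (invariant (iter q g x)) (iter-invariant f g invariant q x)

module _ {k m r : ℕ} {P : FinOrd k} {Q : FinOrd m} where

  Sym-step : ∀ σ S → GeneratorFamily P Q r σ S → ∀ a → Sym P Q r a (σ ⟨$⟩ʳ a)
  Sym-step σ S family@(_ , 2≤r , (_ , _ , _ , cover) , _ , _) a with σ ⟨$⟩ʳ a ≟ a
  ... | yes σa≡a = subst (Sym P Q r a) (sym σa≡a) (reflexive _)
  ... | no σa≢a = return (σ , S , family , cover a (∈-support⁺ σ σa≢a) , 1 , s≤s z≤n , 2≤r , refl)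

  Sym-invariant : ∀ {B : Set} (f : Fin k → B) →
    (∀ σ S → GeneratorFamily P Q r σ S → ∀ x → f (σ ⟨$⟩ʳ x) ≡ f x) → ∀ {a b} → Sym P Q r a b → f a ≡ f b
  Sym-invariant f invariant = gfold ≡.isEquivalence f step
    where
    step : ∀ {a b} → Sym1 P Q r a b → f a ≡ f b
    step (σ , S , family , _ , q , _ , _ , refl) = sym (iter-invariant f (σ ⟨$⟩ʳ_) (invariant σ S family) q _)

  retraction-map : ∀ {k′} (f : Fin k → Fin k′) → (∀ y → ∃[ x ] f x ≡ y) → (∀ a b → f a ≡ f b → Sym P Q r a b) →
    (∀ σ S → GeneratorFamily P Q r σ S → ∀ x → f (σ ⟨$⟩ʳ x) ≡ f x) → IsRetractionMap P Q r f
  retraction-map f onto fibres invariant =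
    strictlySurjective⇒surjective onto , λ a b → fibres a b , Sym-invariant f invariant

  id-retraction : (∀ σ S → GeneratorFamily P Q r σ S → ∀ x → σ ⟨$⟩ʳ x ≡ x) → IsRetractionMap P Q r id
  id-retraction rigid = retraction-map id (λ y → y , refl) (λ a b a≡b → subst (Sym P Q r a) a≡b (reflexive _)) rigid

infix 4 _≐_

_≐_ : ∀ {k} → FinOrd k → FinOrd k → Set
P ≐ P′ = ∀ a b → P a b ≡ P′ a b

module _ {k : ℕ} {P P′ : FinOrd k} (P≐P′ : P ≐ P′) where

  ordCount-cong : ∀ B → ordCount P B ≡ ordCount P′ B
  ordCount-cong B = trans (ordCount≡∑ P B) (trans (∑-cong λ a → ∑-cong λ b → cong (term a b) (P≐P′ a b)) (sym (ordCount≡∑ P′ B)))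
    where
    term : Fin k → Fin k → Bool → ℕ
    term a b Pab = b2n (lookup B a ∧ lookup B b ∧ Pab ∧ not ⌊ a ≟ b ⌋)

  isChain-cong : ∀ {C} → IsChain P C → IsChain P′ C
  isChain-cong chain a b a∈ b∈ with chain a b a∈ b∈
  ... | inj₁ a≤b = inj₁ (trans (sym (P≐P′ a b)) a≤b)
  ... | inj₂ b≤a = inj₂ (trans (sym (P≐P′ b a)) b≤a)

  maxOrdered-cong : ∀ {X A} → MaxOrdered P X A → MaxOrdered P′ X A
  maxOrdered-cong {A = A} (A⊆X , maximal) = A⊆X , λ B B⊆X ∣B∣≡ → subst₂ _≤_ (ordCount-cong B) (ordCount-cong A) (maximal B B⊆X ∣B∣≡)

  subIso-cong : ∀ {m S} {Q : FinOrd m} → SubIso P S Q → SubIso P′ S Q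
  subIso-cong (e , e-inj , e∈S , e-onto , e-iso) = e , e-inj , e∈S , e-onto , λ i j → trans (sym (P≐P′ (e i) (e j))) (e-iso i j)

module _ {k : ℕ} {P P′ : FinOrd k} (P≐P′ : P ≐ P′) where

  private
    P′≐P : P′ ≐ P
    P′≐P a b = sym (P≐P′ a b)

  height-cong : ∀ {S h} → Height P S h → Height P′ S h
  height-cong ((C , C⊆S , chain , ∣C∣≡h) , bound) =
    (C , C⊆S , isChain-cong P≐P′ chain , ∣C∣≡h) , λ C′ C′⊆S chain′ → bound C′ C′⊆S (isChain-cong P′≐P chain′)

  admissible-cong : ∀ {σ r S} → Admissible P σ r S → Admissible P′ σ r S
  admissible-cong {σ} {S = S} (maximal , cyclic , height , cover) =
    (λ i → maxOrdered-cong P≐P′ {A = S i} (maximal i)) , cyclic ,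
    (λ i → let (h , hS , hΣ) = height i in h , height-cong {S i} hS , height-cong {support σ} hΣ) , cover

module _ {k : ℕ} {P P′ : FinOrd k} (P≐P′ : P ≐ P′) where

  generatorFamily-cong : ∀ {m r σ S} {Q : FinOrd m} → GeneratorFamily P Q r σ S → GeneratorFamily P′ Q r σ S
  generatorFamily-cong {r = r} {σ} {S} (aut , 2≤r , adm , iso , minimal) =
    (λ a b → trans (sym (P≐P′ (σ ⟨$⟩ʳ a) (σ ⟨$⟩ʳ b))) (trans (aut a b) (P≐P′ a b))) , 2≤r ,
    admissible-cong P≐P′ {σ} {r} {S} adm , (λ i → subIso-cong P≐P′ {S = S i} (iso i)) ,
    λ T admT → minimal T (admissible-cong (λ a b → sym (P≐P′ a b)) {σ} {r} {T} admT)

  Sym-cong : ∀ {m r a b} {Q : FinOrd m} → Sym P Q r a b → Sym P′ Q r a b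
  Sym-cong {r = r} {Q = Q} = EqClosure.map step
    where
    step : ∀ {a b} → Sym1 P Q r a b → Sym1 P′ Q r a b
    step (σ , S , family , a∈ , power) = σ , S , generatorFamily-cong {r = r} {σ} {S} family , a∈ , power

IsRetractionMap-cong : ∀ {k m k′ r} {P P′ : FinOrd k} {Q : FinOrd m} {f : Fin k → Fin k′} →
  P ≐ P′ → IsRetractionMap P Q r f → IsRetractionMap P′ Q r f
IsRetractionMap-cong P≐P′ (onto , fibres) =
  onto , λ a b → Sym-cong P≐P′ ∘ proj₁ (fibres a b) , proj₂ (fibres a b) ∘ Sym-cong (λ u v → sym (P≐P′ u v))

orbit : ∀ {k} → Permutation′ k → Subset k → Fin 2 → Subset k
orbit σ S₀ zero = S₀
orbit σ S₀ (suc _) = image σ S₀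

module _ {k m : ℕ} {P : FinOrd k} {Q : FinOrd m} (σ : Permutation′ k) (aut : IsAut P σ)
         (involutive : ∀ x → σ ⟨$⟩ʳ (σ ⟨$⟩ʳ x) ≡ x) (S₀ : Subset k) where

  private
    σˡ≡σʳ : ∀ q → σ ⟨$⟩ˡ q ≡ σ ⟨$⟩ʳ q
    σˡ≡σʳ q = trans (sym (involutive (σ ⟨$⟩ˡ q))) (cong (σ ⟨$⟩ʳ_) (inverseʳ σ))

    image-involutive : ∀ B → image σ (image σ B) ≡ B
    image-involutive B = vec-ext λ q → trans (lookup-image σ (image σ B) q) (trans (lookup-image σ B _)
      (cong (lookup B) (trans (cong (σ ⟨$⟩ˡ_) (σˡ≡σʳ q)) (inverseˡ σ))))

    support-invariant : image σ (support σ) ≡ support σ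
    support-invariant = sym (support-conj σ σ σ aut (λ _ → refl))

  involution-generator :
    MaxOrdered P (support σ) S₀ → (∃[ h ] Height P S₀ h × Height P (support σ) h) →
    support σ ⊆ S₀ ∪ image σ S₀ → Empty (S₀ ∩ image σ S₀) → SubIso P S₀ Q →
    GeneratorFamily P Q 2 σ (orbit σ S₀)
  involution-generator max@(S₀⊆Σ , _) (h , hS₀ , hΣ) cover disjoint iso =
    aut , s≤s (s≤s z≤n) , (maximal , cyclic , height , covered) , subIso , minimal
    where
    maximal : ∀ i → MaxOrdered P (support σ) (orbit σ S₀ i)
    maximal zero = max
    maximal (suc _) = subst (λ X → MaxOrdered P X (image σ S₀)) support-invariant (maxOrdered-image σ aut max)

    cyclic : ∀ i → image σ (orbit σ S₀ i) ≡ orbit σ S₀ (next i)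
    cyclic zero = refl
    cyclic (suc zero) = image-involutive S₀

    height : ∀ i → ∃[ h ] (Height P (orbit σ S₀ i) h × Height P (support σ) h)
    height zero = h , hS₀ , hΣ
    height (suc _) = h , height-image σ aut hS₀ , hΣ

    covered : ∀ p → p ∈ support σ → ∃[ i ] p ∈ orbit σ S₀ i
    covered p p∈ with x∈p∪q⁻ S₀ (image σ S₀) (cover p∈)
    ... | inj₁ p∈S₀ = zero , p∈S₀
    ... | inj₂ p∈σS₀ = suc zero , p∈σS₀

    subIso : ∀ i → SubIso P (orbit σ S₀ i) Q
    subIso zero = iso
    subIso (suc _) = subIso-image σ aut iso

    ∣orbit∣ : ∀ i → ∣ orbit σ S₀ i ∣ ≡ ∣ S₀ ∣
    ∣orbit∣ zero = refl
    ∣orbit∣ (suc _) = ∣image∣ σ S₀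

    minimal : ∀ T → Admissible P σ 2 T → ∀ i j → ∣ orbit σ S₀ i ∣ ≤ ∣ T j ∣
    minimal T (_ , cyclicT , _ , coverT) i j = subst₂ _≤_ (sym (∣orbit∣ i)) (sym (∣T∣ j)) (half-≤ (begin
      ∣ S₀ ∣ + ∣ S₀ ∣                   ≡⟨ cong (∣ S₀ ∣ +_) (sym (∣image∣ σ S₀)) ⟩
      ∣ S₀ ∣ + ∣ image σ S₀ ∣           ≤⟨ ∣p∣+∣q∣≤∣p∪q∣ S₀ (image σ S₀) disjoint ⟩
      ∣ S₀ ∪ image σ S₀ ∣               ≤⟨ p⊆q⇒∣p∣≤∣q∣ orbits⊆Σ ⟩
      ∣ support σ ∣                     ≤⟨ p⊆q⇒∣p∣≤∣q∣ Σ⊆T ⟩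
      ∣ T zero ∪ T (suc zero) ∣         ≤⟨ ∣p∪q∣≤∣p∣+∣q∣ (T zero) (T (suc zero)) ⟩
      ∣ T zero ∣ + ∣ T (suc zero) ∣     ≡⟨ cong (∣ T zero ∣ +_) (∣T∣ (suc zero)) ⟩
      ∣ T zero ∣ + ∣ T zero ∣           ∎))
      where
      open ≤-Reasoning
      ∣T∣ : ∀ j → ∣ T j ∣ ≡ ∣ T zero ∣
      ∣T∣ zero = refl
      ∣T∣ (suc zero) = trans (cong ∣_∣ (sym (cyclicT zero))) (∣image∣ σ (T zero))
      orbits⊆Σ : S₀ ∪ image σ S₀ ⊆ support σ
      orbits⊆Σ p∈ with x∈p∪q⁻ S₀ (image σ S₀) p∈
      ... | inj₁ p∈S₀ = S₀⊆Σ p∈S₀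
      ... | inj₂ p∈σS₀ = subst (_ ∈_) support-invariant (image-⊆ σ S₀⊆Σ p∈σS₀)
      Σ⊆T : support σ ⊆ T zero ∪ T (suc zero)
      Σ⊆T {p} p∈ with coverT p p∈
      ... | zero , p∈T = x∈p∪q⁺ (inj₁ p∈T)
      ... | suc zero , p∈T = x∈p∪q⁺ (inj₂ p∈T)

IsAut? : ∀ {k} (P : FinOrd k) (σ : Permutation′ k) → Dec (IsAut P σ)
IsAut? P σ = all? λ a → all? λ b → P (σ ⟨$⟩ʳ a) (σ ⟨$⟩ʳ b) Data.Bool.≟ P a b

module _ {k : ℕ} {a b : Fin k} (a≢b : a ≢ b) where

  transpose-matchˡ : transpose a b ⟨$⟩ʳ a ≡ b
  transpose-matchˡ rewrite dec-true (a ≟ a) refl = refl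

  transpose-matchʳ : transpose a b ⟨$⟩ʳ b ≡ a
  transpose-matchʳ rewrite dec-false (b ≟ a) (λ b≡a → a≢b (sym b≡a)) | dec-true (b ≟ b) refl = refl

  transpose-mismatch : ∀ {x} → x ≢ a → x ≢ b → transpose a b ⟨$⟩ʳ x ≡ x
  transpose-mismatch {x} x≢a x≢b rewrite dec-false (x ≟ a) x≢a | dec-false (x ≟ b) x≢b = refl

  transpose-involutive : ∀ x → transpose a b ⟨$⟩ʳ (transpose a b ⟨$⟩ʳ x) ≡ x
  transpose-involutive x with a ≟ x | b ≟ x
  ... | yes refl | _ = trans (cong (transpose a b ⟨$⟩ʳ_) transpose-matchˡ) transpose-matchʳ
  ... | no _ | yes refl = trans (cong (transpose a b ⟨$⟩ʳ_) transpose-matchʳ) transpose-matchˡ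
  ... | no a≢x | no b≢x = trans (cong (transpose a b ⟨$⟩ʳ_) (transpose-mismatch x≢a x≢b)) (transpose-mismatch x≢a x≢b)
    where
    x≢a : x ≢ a
    x≢a x≡a = a≢x (sym x≡a)
    x≢b : x ≢ b
    x≢b x≡b = b≢x (sym x≡b)

  support-transpose : ∀ {p} → p ∈ support (transpose a b) → p ≡ a ⊎ p ≡ b
  support-transpose {p} p∈ with a ≟ p | b ≟ p
  ... | yes a≡p | _ = inj₁ (sym a≡p)
  ... | no _ | yes b≡p = inj₂ (sym b≡p)
  ... | no a≢p | no b≢p = ⊥-elim (∈-support⁻ (transpose a b) p∈ (transpose-mismatch (λ p≡a → a≢p (sym p≡a)) (λ p≡b → b≢p (sym p≡b))))

module Transposition {k : ℕ} {P : FinOrd k} {a b : Fin k} (a≢b : a ≢ b)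
                     (Paa : P a a ≡ true) (Pbb : P b b ≡ true) (Pab : P a b ≡ false) (Pba : P b a ≡ false) where

  private
    τ = transpose a b

  a∈support : a ∈ support τ
  a∈support = ∈-support⁺ τ (λ τa≡a → a≢b (trans (sym τa≡a) (transpose-matchˡ a≢b)))

  ⁅a⁆⊆support : ⁅ a ⁆ ⊆ support τ
  ⁅a⁆⊆support p∈ = subst (_∈ support τ) (sym (x∈⁅y⁆⇒x≡y a p∈)) a∈support

  support-antichain : ∀ {x y} → x ∈ support τ → y ∈ support τ → lt P x y ≡ false
  support-antichain {x} {y} x∈ y∈ with x ≟ y | support-transpose a≢b x∈ | support-transpose a≢b y∈
  ... | yes _ | _ | _ = ∧-zeroʳ (P x y)
  ... | no x≢y | inj₁ refl | inj₁ refl = ⊥-elim (x≢y refl)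
  ... | no _ | inj₁ refl | inj₂ refl = cong (_∧ true) Pab
  ... | no _ | inj₂ refl | inj₁ refl = cong (_∧ true) Pba
  ... | no x≢y | inj₂ refl | inj₂ refl = ⊥-elim (x≢y refl)

  support-chain : ∀ {C x y} → IsChain P C → C ⊆ support τ → x ∈ C → y ∈ C → x ≡ y
  support-chain {C} {x} {y} chain C⊆Σ x∈C y∈C with support-transpose a≢b (C⊆Σ x∈C) | support-transpose a≢b (C⊆Σ y∈C) | chain x y x∈C y∈C
  ... | inj₁ refl | inj₁ refl | _ = refl
  ... | inj₂ refl | inj₂ refl | _ = refl
  ... | inj₁ refl | inj₂ refl | inj₁ Pxy = ⊥-elim (true≢false (trans (sym Pxy) Pab))
  ... | inj₁ refl | inj₂ refl | inj₂ Pyx = ⊥-elim (true≢false (trans (sym Pyx) Pba))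
  ... | inj₂ refl | inj₁ refl | inj₁ Pxy = ⊥-elim (true≢false (trans (sym Pxy) Pba))
  ... | inj₂ refl | inj₁ refl | inj₂ Pyx = ⊥-elim (true≢false (trans (sym Pyx) Pab))

  maximal : MaxOrdered P (support τ) ⁅ a ⁆
  maximal = ⁅a⁆⊆support , λ B B⊆Σ _ →
    ≤-trans (≤-reflexive (ordCount-antichain P B λ x∈ y∈ → support-antichain (B⊆Σ x∈) (B⊆Σ y∈))) z≤n

  height : ∀ {S} → ⁅ a ⁆ ⊆ S → S ⊆ support τ → Height P S 1
  height ⁅a⁆⊆S S⊆Σ = (⁅ a ⁆ , ⁅a⁆⊆S , singleton-chain , ∣⁅x⁆∣≡1 a) ,
    λ C C⊆S chain → ∣p∣≤1 C (support-chain chain (λ x∈ → S⊆Σ (C⊆S x∈)))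
    where
    singleton-chain : IsChain P ⁅ a ⁆
    singleton-chain x y x∈ y∈ rewrite x∈⁅y⁆⇒x≡y a x∈ | x∈⁅y⁆⇒x≡y a y∈ = inj₁ Paa

  cover : support τ ⊆ ⁅ a ⁆ ∪ image τ ⁅ a ⁆
  cover p∈ with support-transpose a≢b p∈
  ... | inj₁ refl = x∈p∪q⁺ (inj₁ (x∈⁅x⁆ a))
  ... | inj₂ refl = x∈p∪q⁺ (inj₂ (subst (_∈ image τ ⁅ a ⁆) (transpose-matchˡ a≢b) (∈-image⁺′ τ (x∈⁅x⁆ a))))

  disjoint : Empty (⁅ a ⁆ ∩ image τ ⁅ a ⁆)
  disjoint (x , x∈) with x∈p∩q⁻ ⁅ a ⁆ (image τ ⁅ a ⁆) x∈
  ... | x∈⁅a⁆ , x∈τ⁅a⁆ = a≢b (begin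
    a                          ≡⟨ sym (x∈⁅y⁆⇒x≡y a x∈⁅a⁆) ⟩
    x                          ≡⟨ sym (inverseʳ τ) ⟩
    τ ⟨$⟩ʳ (τ ⟨$⟩ˡ x)          ≡⟨ cong (τ ⟨$⟩ʳ_) (x∈⁅y⁆⇒x≡y a (∈-image⁻ τ x∈τ⁅a⁆)) ⟩
    τ ⟨$⟩ʳ a                   ≡⟨ transpose-matchˡ a≢b ⟩
    b                          ∎)
    where open ≡-Reasoning

  point-iso : (Q : FinOrd 1) → Q zero zero ≡ true → SubIso P ⁅ a ⁆ Q
  point-iso Q Q00 = (λ _ → a) , (λ { {zero} {zero} _ → refl }) , (λ _ → x∈⁅x⁆ a) , (λ p p∈ → zero , sym (x∈⁅y⁆⇒x≡y a p∈)) ,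
                    λ { zero zero → trans Paa (sym Q00) }

  Sym-transpose : (Q : FinOrd 1) → Q zero zero ≡ true → IsAut P τ → Sym P Q 2 a b
  Sym-transpose Q Q00 aut =
    return (τ , orbit τ ⁅ a ⁆ , family , (zero , x∈⁅x⁆ a) , 1 , s≤s z≤n , s≤s (s≤s z≤n) , sym (transpose-matchˡ a≢b))
    where
    family = involution-generator τ aut (transpose-involutive a≢b) ⁅ a ⁆ maximal
      (1 , height (λ p∈ → p∈) ⁅a⁆⊆support , height ⁅a⁆⊆support (λ p∈ → p∈)) cover disjoint (point-iso Q Q00)

private
  or-tabulate-true : ∀ {k} (p : Fin k → Bool) x → p x ≡ true → or (List.tabulate p) ≡ true
  or-tabulate-true p zero px = ∨-trueˡ _ px
  or-tabulate-true p (suc x) px = ∨-trueʳ (p zero) (or-tabulate-true (λ i → p (suc i)) x px)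

  or-tabulate-false : ∀ {k} (p : Fin k → Bool) → (∀ x → p x ≡ false) → or (List.tabulate p) ≡ false
  or-tabulate-false {zero} p _ = refl
  or-tabulate-false {suc k} p false! = cong₂ _∨_ (false! zero) (or-tabulate-false (λ i → p (suc i)) (λ i → false! (suc i)))

  any-allFin : ∀ {k} (p : Fin k → Bool) → any p (allFin k) ≡ or (List.tabulate p)
  any-allFin p = cong or (map-tabulate (λ i → i) p)

module _ {k k′ : ℕ} (P : FinOrd k) (f : Fin k → Fin k′) {u v : Fin k′} where

  private
    related : Fin k → Fin k → Bool
    related a b = ⌊ f a ≟ u ⌋ ∧ ⌊ f b ≟ v ⌋ ∧ P a b

    row : Fin k → Bool
    row a = any (related a) (allFin k)

  induced-true : ∀ a b → f a ≡ u → f b ≡ v → P a b ≡ true → induced P f u v ≡ true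
  induced-true a b fa≡u fb≡v Pab =
    trans (any-allFin row) (or-tabulate-true row a (trans (any-allFin (related a)) (or-tabulate-true (related a) b
      (trans (cong₂ (λ x y → x ∧ y ∧ P a b) (⌊⌋-true⁺ (f a ≟ u) fa≡u) (⌊⌋-true⁺ (f b ≟ v) fb≡v)) Pab))))

  induced-false : (∀ a b → f a ≡ u → f b ≡ v → P a b ≡ false) → induced P f u v ≡ false
  induced-false unrelated =
    trans (any-allFin row) (or-tabulate-false row λ a → trans (any-allFin (related a)) (or-tabulate-false (related a) (term a)))
    where
    term : ∀ a b → related a b ≡ false
    term a b with f a ≟ u | f b ≟ v
    ... | yes fa≡u | yes fb≡v = unrelated a b fa≡u fb≡v
    ... | yes _ | no _ = refl
    ... | no _ | _ = refl

induced-cong : ∀ {k k′} {P P′ : FinOrd k} (f : Fin k → Fin k′) → P ≐ P′ → induced P f ≐ induced P′ f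
induced-cong {k} f P≐P′ u v =
  cong or (map-cong (λ a → cong or (map-cong (λ b → cong (λ z → ⌊ f a ≟ u ⌋ ∧ ⌊ f b ≟ v ⌋ ∧ z) (P≐P′ a b)) (allFin k))) (allFin k))

≐⇒OrdIso : ∀ {k} {P R : FinOrd k} → R ≐ P → OrdIso P R
≐⇒OrdIso R≐P = id , (λ eq → eq) , (λ y → y , λ eq → eq) , R≐P

-- The 2n-gon

isEven-suc : ∀ v → isEven (suc v) ≡ not (isEven v)
isEven-suc zero = refl
isEven-suc (suc v) = sym (trans (cong not (isEven-suc v)) (not-involutive (isEven v)))

isEven-+ : ∀ a b → isEven (a + b) ≡ (if isEven a then isEven b else not (isEven b))
isEven-+ zero b = refl
isEven-+ (suc zero) b = isEven-suc b
isEven-+ (suc (suc a)) b = isEven-+ a b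

isEven-+-true : ∀ a b → isEven (a + b) ≡ true → isEven a ≡ isEven b
isEven-+-true a b even-sum with isEven a | isEven b | trans (sym (isEven-+ a b)) even-sum
... | true | true | _ = refl
... | false | false | _ = refl

isEven-2* : ∀ n → isEven (2 * n) ≡ true
isEven-2* zero = refl
isEven-2* (suc n) = trans (cong (isEven ∘ (1 +_)) (+-suc n (n + 0))) (isEven-2* n)

module Polygon (n : ℕ) .{{_ : NonZero n}} where

  K : ℕ
  K = 2 * n

  0<K : 0 < K
  0<K = ≤-trans (Data.Nat.>-nonZero⁻¹ n) (m≤m+n n (n + 0))

  𝟘 : Fin K
  𝟘 = fromℕ< 0<K

  even : Fin K → Bool
  even x = isEven (toℕ x)

  IsNext : Fin K → Fin K → Set
  IsNext x y = suc (toℕ x) ≡ toℕ y ⊎ (suc (toℕ x) ≡ K × toℕ y ≡ 0)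

  -- csuc is only used through isNext-csuc; keeping it opaque stops the type checker from unfolding it.
  opaque
    csuc : Fin K → Fin K
    csuc x with suc (toℕ x) <? K
    ... | yes x+1<K = fromℕ< x+1<K
    ... | no _ = 𝟘

    isNext-csuc : ∀ x → IsNext x (csuc x)
    isNext-csuc x with suc (toℕ x) <? K
    ... | yes x+1<K = inj₁ (sym (toℕ-fromℕ< x+1<K))
    ... | no x+1≮K = inj₂ (≤-antisym (toℕ<n x) (≮⇒≥ x+1≮K) , toℕ-fromℕ< 0<K)

  isNext-unique : ∀ {x y z} → IsNext x y → IsNext x z → y ≡ z
  isNext-unique (inj₁ x+1≡y) (inj₁ x+1≡z) = toℕ-injective (trans (sym x+1≡y) x+1≡z)
  isNext-unique {y = y} (inj₁ x+1≡y) (inj₂ (x+1≡K , _)) = ⊥-elim (<-irrefl (trans (sym x+1≡y) x+1≡K) (toℕ<n y))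
  isNext-unique {z = z} (inj₂ (x+1≡K , _)) (inj₁ x+1≡z) = ⊥-elim (<-irrefl (trans (sym x+1≡z) x+1≡K) (toℕ<n z))
  isNext-unique (inj₂ (_ , y≡0)) (inj₂ (_ , z≡0)) = toℕ-injective (trans y≡0 (sym z≡0))

  csuc-unique : ∀ {x y} → IsNext x y → csuc x ≡ y
  csuc-unique = isNext-unique (isNext-csuc _)

  opposite-+ : ∀ x → toℕ (opposite x) + suc (toℕ x) ≡ K
  opposite-+ x = trans (cong (_+ suc (toℕ x)) (opposite-prop x)) (m∸n+n≡m (toℕ<n x))

  isNext-opposite : ∀ {x y} → IsNext x y → IsNext (opposite y) (opposite x)
  isNext-opposite {x} {y} (inj₁ x+1≡y) = inj₁ (+-cancelʳ-≡ (suc (toℕ x)) _ _ (begin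
    suc (toℕ (opposite y)) + suc (toℕ x)    ≡⟨ sym (+-suc (toℕ (opposite y)) (suc (toℕ x))) ⟩
    toℕ (opposite y) + suc (suc (toℕ x))    ≡⟨ cong (λ v → toℕ (opposite y) + suc v) x+1≡y ⟩
    toℕ (opposite y) + suc (toℕ y)          ≡⟨ opposite-+ y ⟩
    K                                       ≡⟨ sym (opposite-+ x) ⟩
    toℕ (opposite x) + suc (toℕ x)          ∎))
    where open ≡-Reasoning
  isNext-opposite {x} {y} (inj₂ (x+1≡K , y≡0)) =
    inj₂ (trans (+-comm 1 (toℕ (opposite y))) (trans (cong (λ v → toℕ (opposite y) + suc v) (sym y≡0)) (opposite-+ y)) ,
          +-cancelʳ-≡ (suc (toℕ x)) _ _ (trans (opposite-+ x) (sym x+1≡K)))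

  -- x ↦ −x (mod K)
  mirror : Fin K → Fin K
  mirror = csuc ∘ opposite

  -- opposite x = K − 1 − x, so this is x ↦ x − 1.
  cpred : Fin K → Fin K
  cpred = opposite ∘ mirror

  mirror-csuc′ : ∀ x → mirror (csuc x) ≡ opposite x
  mirror-csuc′ x = csuc-unique (isNext-opposite (isNext-csuc x))

  mirror-involutive : ∀ x → mirror (mirror x) ≡ x
  mirror-involutive x = trans (mirror-csuc′ (opposite x)) (opposite-involutive x)

  csuc-cpred : ∀ x → csuc (cpred x) ≡ x
  csuc-cpred = mirror-involutive

  cpred-csuc : ∀ x → cpred (csuc x) ≡ x
  cpred-csuc x = trans (cong opposite (mirror-csuc′ x)) (opposite-involutive x)

  mirror-csuc : ∀ x → mirror (csuc x) ≡ cpred (mirror x)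
  mirror-csuc x = trans (mirror-csuc′ x) (cong opposite (sym (mirror-involutive x)))

  mirror-cpred : ∀ x → mirror (cpred x) ≡ csuc (mirror x)
  mirror-cpred x = sym (trans (cong csuc (trans (cong mirror (sym (csuc-cpred x))) (mirror-csuc (cpred x)))) (csuc-cpred _))

  csuc-injective : Injective _≡_ _≡_ csuc
  csuc-injective {x} {y} eq = trans (sym (cpred-csuc x)) (trans (cong cpred eq) (cpred-csuc y))

  cpred-injective : Injective _≡_ _≡_ cpred
  cpred-injective {x} {y} eq = trans (sym (csuc-cpred x)) (trans (cong csuc eq) (csuc-cpred y))

  mirror-𝟘 : mirror 𝟘 ≡ 𝟘
  mirror-𝟘 with isNext-csuc (opposite 𝟘)
  ... | inj₂ (_ , m0≡0) = toℕ-injective (trans m0≡0 (sym (toℕ-fromℕ< 0<K)))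
  ... | inj₁ o0+1≡m0 = ⊥-elim (<-irrefl (trans (sym o0+1≡m0) o0+1≡K) (toℕ<n (mirror 𝟘)))
    where
    o0+1≡K : suc (toℕ (opposite 𝟘)) ≡ K
    o0+1≡K = trans (+-comm 1 _) (trans (cong (λ v → toℕ (opposite 𝟘) + suc v) (sym (toℕ-fromℕ< 0<K))) (opposite-+ 𝟘))

  mirror-+ : ∀ {x : Fin K} → 1 ≤ toℕ x → toℕ (mirror x) + toℕ x ≡ K
  mirror-+ {x} 1≤x with isNext-csuc (opposite x)
  ... | inj₁ o+1≡m = trans (cong (_+ toℕ x) (sym o+1≡m)) (trans (sym (+-suc _ (toℕ x))) (opposite-+ x))
  ... | inj₂ (o+1≡K , _) = ⊥-elim (<-irrefl (sym x≡0) 1≤x)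
    where
    x≡0 : toℕ x ≡ 0
    x≡0 = ℕ.suc-injective (ℕ.+-cancelˡ-≡ (toℕ (opposite x)) _ _ (trans (opposite-+ x) (trans (sym o+1≡K) (+-comm 1 _))))

  even-csuc : ∀ x → even (csuc x) ≡ not (even x)
  even-csuc x with isNext-csuc x
  ... | inj₁ x+1≡y = trans (cong isEven (sym x+1≡y)) (isEven-suc (toℕ x))
  ... | inj₂ (x+1≡K , y≡0) = trans (cong isEven y≡0) (sym (trans (sym (isEven-suc (toℕ x))) (trans (cong isEven x+1≡K) (isEven-2* n))))

  even-opposite : ∀ x → even (opposite x) ≡ not (even x)
  even-opposite x = trans (isEven-+-true (toℕ (opposite x)) (suc (toℕ x)) (trans (cong isEven (opposite-+ x)) (isEven-2* n))) (isEven-suc (toℕ x))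

  even-mirror : ∀ x → even (mirror x) ≡ even x
  even-mirror x = trans (even-csuc (opposite x)) (trans (cong not (even-opposite x)) (not-involutive (even x)))

  even-cpred : ∀ x → even (cpred x) ≡ not (even x)
  even-cpred x = trans (even-opposite (mirror x)) (cong not (even-mirror x))

  csuc≢ : ∀ x → csuc x ≢ x
  csuc≢ x eq = not-≢ (trans (sym (even-csuc x)) (cong even eq))
    where
    not-≢ : ∀ {b} → not b ≢ b
    not-≢ {true} ()
    not-≢ {false} ()

  cpred≢ : ∀ x → cpred x ≢ x
  cpred≢ x eq = csuc≢ x (trans (cong csuc (sym eq)) (csuc-cpred x))

  adjacent : Fin K → Fin K → Bool
  adjacent a b = ⌊ b ≟ csuc a ⌋ ∨ ⌊ a ≟ csuc b ⌋

  private
    ∨-shuffle : ∀ a b c d → a ∨ (b ∨ (c ∨ d)) ≡ (a ∨ d) ∨ (b ∨ c)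
    ∨-shuffle true _ _ _ = refl
    ∨-shuffle false true _ d = sym (∨-zeroʳ d)
    ∨-shuffle false false c d = ∨-comm c d

    successor : ℕ → ℕ → Bool
    successor i j = (suc i ≡ᵇ j) ∨ ((j ≡ᵇ 0) ∧ (suc i ≡ᵇ 2 * n))

    successor-csuc : ∀ a b → successor (toℕ a) (toℕ b) ≡ ⌊ b ≟ csuc a ⌋
    successor-csuc a b = bool-ext ⇒ ⇐
      where
      isNext⇒≟ : IsNext a b → ⌊ b ≟ csuc a ⌋ ≡ true
      isNext⇒≟ a→b = trans (cong (λ c → ⌊ b ≟ c ⌋) (csuc-unique a→b)) (≟-refl b)
      ⇒ : successor (toℕ a) (toℕ b) ≡ true → ⌊ b ≟ csuc a ⌋ ≡ true
      ⇒ succ with ∨-true⁻ {suc (toℕ a) ≡ᵇ toℕ b} succ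
      ... | inj₁ a+1≡b = isNext⇒≟ (inj₁ (≡ᵇ-true⁻ a+1≡b))
      ... | inj₂ wrap = let (b≡0 , a+1≡K) = ∧-true⁻ {toℕ b ≡ᵇ 0} wrap in isNext⇒≟ (inj₂ (≡ᵇ-true⁻ a+1≡K , ≡ᵇ-true⁻ b≡0))
      ⇐ : ⌊ b ≟ csuc a ⌋ ≡ true → successor (toℕ a) (toℕ b) ≡ true
      ⇐ b≟ with subst (IsNext a) (sym (≟-true⁻ b≟)) (isNext-csuc a)
      ... | inj₁ a+1≡b = ∨-trueˡ ((toℕ b ≡ᵇ 0) ∧ (suc (toℕ a) ≡ᵇ 2 * n)) (≡ᵇ-true⁺ a+1≡b)
      ... | inj₂ (a+1≡K , b≡0) = ∨-trueʳ (suc (toℕ a) ≡ᵇ toℕ b) (cong₂ _∧_ (≡ᵇ-true⁺ b≡0) (≡ᵇ-true⁺ a+1≡K))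

  gon-adjacent : ∀ a b → gon n a b ≡ ⌊ a ≟ b ⌋ ∨ (even a ∧ adjacent a b)
  gon-adjacent a b = cong (λ z → ⌊ a ≟ b ⌋ ∨ (even a ∧ z)) (begin
    cycAdj n (toℕ a) (toℕ b)
      ≡⟨ ∨-shuffle (suc (toℕ a) ≡ᵇ toℕ b) (suc (toℕ b) ≡ᵇ toℕ a) ((toℕ a ≡ᵇ 0) ∧ (suc (toℕ b) ≡ᵇ 2 * n)) _ ⟩
    successor (toℕ a) (toℕ b) ∨ successor (toℕ b) (toℕ a)     ≡⟨ cong₂ _∨_ (successor-csuc a b) (successor-csuc b a) ⟩
    adjacent a b                                               ∎)
    where open ≡-Reasoning

  ≟-csuc : ∀ a b → ⌊ a ≟ csuc b ⌋ ≡ ⌊ b ≟ cpred a ⌋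
  ≟-csuc a b = begin
    ⌊ a ≟ csuc b ⌋                  ≡⟨ sym (≟-injective cpred cpred-injective a (csuc b)) ⟩
    ⌊ cpred a ≟ cpred (csuc b) ⌋    ≡⟨ cong (λ c → ⌊ cpred a ≟ c ⌋) (cpred-csuc b) ⟩
    ⌊ cpred a ≟ b ⌋                 ≡⟨ ≟-sym (cpred a) b ⟩
    ⌊ b ≟ cpred a ⌋                 ∎
    where open ≡-Reasoning

  lt-gon : ∀ a b → lt (gon n) a b ≡ even a ∧ (⌊ b ≟ csuc a ⌋ ∨ ⌊ b ≟ cpred a ⌋)
  lt-gon a b rewrite gon-adjacent a b | ≟-csuc a b with a ≟ b
  ... | yes refl rewrite ≟-≢ (λ a≡csuc → csuc≢ a (sym a≡csuc)) | ≟-≢ (λ a≡cpred → cpred≢ a (sym a≡cpred)) = sym (∧-zeroʳ (even a))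
  ... | no _ = ∧-identityʳ _

  lt-gon⁻ : ∀ a b → lt (gon n) a b ≡ true → even a ≡ true × (b ≡ csuc a ⊎ b ≡ cpred a)
  lt-gon⁻ a b a<b with ∧-true⁻ {even a} (trans (sym (lt-gon a b)) a<b)
  ... | even-a , b≟ with ∨-true⁻ {⌊ b ≟ csuc a ⌋} b≟
  ...   | inj₁ b≟csuc = even-a , inj₁ (≟-true⁻ b≟csuc)
  ...   | inj₂ b≟cpred = even-a , inj₂ (≟-true⁻ b≟cpred)

  lt-parity : ∀ a b → lt (gon n) a b ≡ true → even a ≡ true × even b ≡ false
  lt-parity a b a<b with lt-gon⁻ a b a<b
  ... | even-a , inj₁ b≡csuc = even-a , trans (cong even b≡csuc) (trans (even-csuc a) (cong not even-a))
  ... | even-a , inj₂ b≡cpred = even-a , trans (cong even b≡cpred) (trans (even-cpred a) (cong not even-a))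

  lt-csuc : ∀ x → even x ≡ true → lt (gon n) x (csuc x) ≡ true
  lt-csuc x even-x = trans (lt-gon x (csuc x)) (cong₂ _∧_ even-x (∨-trueˡ _ (≟-refl (csuc x))))

  lt-cpred : ∀ x → even x ≡ true → lt (gon n) x (cpred x) ≡ true
  lt-cpred x even-x = trans (lt-gon x (cpred x)) (cong₂ _∧_ even-x (∨-trueʳ _ (≟-refl (cpred x))))

  csuc-lt : ∀ x → even x ≡ false → lt (gon n) (csuc x) x ≡ true
  csuc-lt x odd-x = subst (λ y → lt (gon n) (csuc x) y ≡ true) (cpred-csuc x)
    (lt-cpred (csuc x) (trans (even-csuc x) (cong not odd-x)))

  cpred-lt : ∀ x → even x ≡ false → lt (gon n) (cpred x) x ≡ true
  cpred-lt x odd-x = subst (λ y → lt (gon n) (cpred x) y ≡ true) (csuc-cpred x)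
    (lt-csuc (cpred x) (trans (even-cpred x) (cong not odd-x)))

  gon-refl : ∀ x → gon n x x ≡ true
  gon-refl x = ∨-trueˡ _ (≟-refl x)

  ≤-parity : ∀ a b → gon n a b ≡ true → a ≡ b ⊎ (even a ≡ true × even b ≡ false)
  ≤-parity a b a≤b with b ≟ a
  ... | yes b≡a = inj₁ (sym b≡a)
  ... | no b≢a = inj₂ (lt-parity a b (cong₂ _∧_ a≤b (cong not (≟-≢ (λ a≡b → b≢a (sym a≡b))))))

  module _ (φ : Fin K → Fin K) (φ-injective : Injective _≡_ _≡_ φ) (even-φ : ∀ x → even (φ x) ≡ even x) where

    private
      gon-preserved : (∀ a b → adjacent (φ a) (φ b) ≡ adjacent a b) → ∀ a b → gon n (φ a) (φ b) ≡ gon n a b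
      gon-preserved adjacent-φ a b = begin
        gon n (φ a) (φ b)                                         ≡⟨ gon-adjacent (φ a) (φ b) ⟩
        ⌊ φ a ≟ φ b ⌋ ∨ (even (φ a) ∧ adjacent (φ a) (φ b))      ≡⟨ cong₂ _∨_ (≟-injective φ φ-injective a b) (cong₂ _∧_ (even-φ a) (adjacent-φ a b)) ⟩
        ⌊ a ≟ b ⌋ ∨ (even a ∧ adjacent a b)                       ≡⟨ sym (gon-adjacent a b) ⟩
        gon n a b                                                  ∎
        where open ≡-Reasoning

    rotation-aut : (∀ x → φ (csuc x) ≡ csuc (φ x)) → ∀ a b → gon n (φ a) (φ b) ≡ gon n a b
    rotation-aut φ-csuc = gon-preserved λ a b → cong₂ _∨_ (step a b) (step b a)
      where
      step : ∀ a b → ⌊ φ b ≟ csuc (φ a) ⌋ ≡ ⌊ b ≟ csuc a ⌋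
      step a b = trans (cong (λ c → ⌊ φ b ≟ c ⌋) (sym (φ-csuc a))) (≟-injective φ φ-injective b (csuc a))

    reflection-aut : (∀ x → φ (csuc x) ≡ cpred (φ x)) → ∀ a b → gon n (φ a) (φ b) ≡ gon n a b
    reflection-aut φ-csuc = gon-preserved λ a b → trans (cong₂ _∨_ (step a b) (step b a)) (∨-comm ⌊ a ≟ csuc b ⌋ ⌊ b ≟ csuc a ⌋)
      where
      csuc-φ : ∀ x → csuc (φ x) ≡ φ (cpred x)
      csuc-φ x = trans (cong (csuc ∘ φ) (sym (csuc-cpred x))) (trans (cong csuc (φ-csuc (cpred x))) (csuc-cpred _))
      step : ∀ a b → ⌊ φ b ≟ csuc (φ a) ⌋ ≡ ⌊ a ≟ csuc b ⌋
      step a b = begin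
        ⌊ φ b ≟ csuc (φ a) ⌋    ≡⟨ cong (λ c → ⌊ φ b ≟ c ⌋) (csuc-φ a) ⟩
        ⌊ φ b ≟ φ (cpred a) ⌋   ≡⟨ ≟-injective φ φ-injective b (cpred a) ⟩
        ⌊ b ≟ cpred a ⌋         ≡⟨ sym (≟-csuc a b) ⟩
        ⌊ a ≟ csuc b ⌋          ∎
        where open ≡-Reasoning

  mirrorᵖ : Permutation′ K
  mirrorᵖ = permutation mirror mirror mirror-involutive mirror-involutive

  mirror-aut : IsAut (gon n) mirrorᵖ
  mirror-aut = reflection-aut mirror mirror-injective even-mirror mirror-csuc
    where
    mirror-injective : Injective _≡_ _≡_ mirror
    mirror-injective {x} {y} eq = trans (sym (mirror-involutive x)) (trans (cong mirror eq) (mirror-involutive y))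

  csuc² cpred² : Fin K → Fin K
  csuc² = csuc ∘ csuc
  cpred² = cpred ∘ cpred

  rotate₂ : Permutation′ K
  rotate₂ = permutation csuc² cpred² (λ x → trans (cong csuc (csuc-cpred (cpred x))) (csuc-cpred x))
                                     (λ x → trans (cong cpred (cpred-csuc (csuc x))) (cpred-csuc x))

  rotate₂-aut : IsAut (gon n) rotate₂
  rotate₂-aut = rotation-aut csuc² (λ eq → csuc-injective (csuc-injective eq))
    (λ x → trans (even-csuc (csuc x)) (trans (cong not (even-csuc x)) (not-involutive (even x)))) (λ _ → refl)


  𝟙 𝟚 𝟛 : Fin K
  𝟙 = csuc 𝟘
  𝟚 = csuc 𝟙
  𝟛 = csuc 𝟚

  toℕ-iter-csuc : ∀ v → v < K → toℕ (iter v csuc 𝟘) ≡ v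
  toℕ-iter-csuc zero _ = toℕ-fromℕ< 0<K
  toℕ-iter-csuc (suc v) v+1<K with isNext-csuc (iter v csuc 𝟘)
  ... | inj₁ next≡ = trans (sym next≡) (cong suc (toℕ-iter-csuc v (≤-trans (n≤1+n _) v+1<K)))
  ... | inj₂ (last , _) = ⊥-elim (<-irrefl (trans (cong suc (sym (toℕ-iter-csuc v (≤-trans (n≤1+n _) v+1<K)))) last) v+1<K)

  iter-csuc-toℕ : ∀ x → iter (toℕ x) csuc 𝟘 ≡ x
  iter-csuc-toℕ x = toℕ-injective (toℕ-iter-csuc (toℕ x) (toℕ<n x))

  module _ (σ : Permutation′ K) (aut : IsAut (gon n) σ) where

    private
      σ-lt : ∀ a b → lt (gon n) a b ≡ true → lt (gon n) (σ ⟨$⟩ʳ a) (σ ⟨$⟩ʳ b) ≡ true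
      σ-lt a b a<b = trans (lt-aut σ aut a b) a<b

    even-aut : ∀ x → even (σ ⟨$⟩ʳ x) ≡ even x
    even-aut x with even x in even-x
    ... | true = proj₁ (lt-parity (σ ⟨$⟩ʳ x) (σ ⟨$⟩ʳ csuc x) (σ-lt x (csuc x) (lt-csuc x even-x)))
    ... | false = proj₂ (lt-parity (σ ⟨$⟩ʳ cpred x) (σ ⟨$⟩ʳ x) (σ-lt (cpred x) x (cpred-lt x even-x)))

    neighbour-aut : ∀ x → σ ⟨$⟩ʳ csuc x ≡ csuc (σ ⟨$⟩ʳ x) ⊎ σ ⟨$⟩ʳ csuc x ≡ cpred (σ ⟨$⟩ʳ x)
    neighbour-aut x with even x in even-x
    ... | true = proj₂ (lt-gon⁻ (σ ⟨$⟩ʳ x) (σ ⟨$⟩ʳ csuc x) (σ-lt x (csuc x) (lt-csuc x even-x)))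
    ... | false with proj₂ (lt-gon⁻ (σ ⟨$⟩ʳ csuc x) (σ ⟨$⟩ʳ x) (σ-lt (csuc x) x (csuc-lt x even-x)))
    ...   | inj₁ σx≡ = inj₂ (trans (sym (cpred-csuc _)) (cong cpred (sym σx≡)))
    ...   | inj₂ σx≡ = inj₁ (trans (sym (csuc-cpred _)) (cong csuc (sym σx≡)))

  csucᵖ : Permutation′ K
  csucᵖ = permutation csuc cpred csuc-cpred cpred-csuc

  toℕ-cpred : ∀ {x v} → toℕ x ≡ suc v → toℕ (cpred x) ≡ v
  toℕ-cpred {x} x≡v+1 with subst (IsNext (cpred x)) (csuc-cpred x) (isNext-csuc (cpred x))
  ... | inj₁ next≡ = ℕ.suc-injective (trans next≡ x≡v+1)
  ... | inj₂ (_ , x≡0) = ⊥-elim (ℕ.0≢1+n (trans (sym x≡0) x≡v+1))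

  evens : Subset K
  evens = tabulate even

  even⇒∈evens : ∀ {x} → even x ≡ true → x ∈ evens
  even⇒∈evens {x} even-x = lookup⇒[]= x evens (trans (lookup∘tabulate even x) even-x)

  ∈evens⇒even : ∀ {x} → x ∈ evens → even x ≡ true
  ∈evens⇒even {x} x∈ = trans (sym (lookup∘tabulate even x)) ([]=⇒lookup x∈)

  ∉evens⇒odd : ∀ {x} → x ∉ evens → even x ≡ false
  ∉evens⇒odd {x} x∉ with even x in even-x
  ... | true = ⊥-elim (x∉ (even⇒∈evens even-x))
  ... | false = refl

  ≤-same-parity : ∀ a b → gon n a b ≡ true → even a ≡ even b → a ≡ b
  ≤-same-parity a b a≤b same with ≤-parity a b a≤b
  ... | inj₁ a≡b = a≡b
  ... | inj₂ (even-a , odd-b) = ⊥-elim (true≢false (trans (sym even-a) (trans same odd-b)))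

  chain-parity : ∀ {C x y} → IsChain (gon n) C → x ∈ C → y ∈ C → even x ≡ even y → x ≡ y
  chain-parity {x = x} {y} chain x∈ y∈ same with chain x y x∈ y∈
  ... | inj₁ x≤y = ≤-same-parity x y x≤y same
  ... | inj₂ y≤x = sym (≤-same-parity y x y≤x (sym same))

  ∣chain∣≤2 : ∀ C → IsChain (gon n) C → ∣ C ∣ ≤ 2
  ∣chain∣≤2 C chain = begin
    ∣ C ∣                               ≤⟨ p⊆q⇒∣p∣≤∣q∣ split ⟩
    ∣ C ∩ evens ∪ C ∩ ∁ evens ∣         ≤⟨ ∣p∪q∣≤∣p∣+∣q∣ (C ∩ evens) (C ∩ ∁ evens) ⟩
    ∣ C ∩ evens ∣ + ∣ C ∩ ∁ evens ∣     ≤⟨ +-mono-≤ (∣p∣≤1 (C ∩ evens) same-even) (∣p∣≤1 (C ∩ ∁ evens) same-odd) ⟩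
    2                                   ∎
    where
    open ℕ.≤-Reasoning
    split : C ⊆ C ∩ evens ∪ C ∩ ∁ evens
    split {x} x∈C with x ∈? evens
    ... | yes x∈E = x∈p∪q⁺ (inj₁ (x∈p∩q⁺ (x∈C , x∈E)))
    ... | no x∉E = x∈p∪q⁺ (inj₂ (x∈p∩q⁺ (x∈C , x∉p⇒x∈∁p x∉E)))
    same-even : ∀ {x y} → x ∈ C ∩ evens → y ∈ C ∩ evens → x ≡ y
    same-even x∈ y∈ with x∈p∩q⁻ C evens x∈ | x∈p∩q⁻ C evens y∈
    ... | x∈C , x∈E | y∈C , y∈E = chain-parity chain x∈C y∈C (trans (∈evens⇒even x∈E) (sym (∈evens⇒even y∈E)))
    same-odd : ∀ {x y} → x ∈ C ∩ ∁ evens → y ∈ C ∩ ∁ evens → x ≡ y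
    same-odd x∈ y∈ with x∈p∩q⁻ C (∁ evens) x∈ | x∈p∩q⁻ C (∁ evens) y∈
    ... | x∈C , x∈O | y∈C , y∈O =
      chain-parity chain x∈C y∈C (trans (∉evens⇒odd (x∈∁p⇒x∉p x∈O)) (sym (∉evens⇒odd (x∈∁p⇒x∉p y∈O))))

  -- Without 0, B is a union of paths along csuc: the first vertex of a path has no edge coming in.
  edges-path-bound : ∀ B → 𝟘 ∉ B → Nonempty B → ∣ B ∩ image csucᵖ B ∣ < ∣ B ∣
  edges-path-bound B 𝟘∉B (y , y∈B) = p⊂q⇒∣p∣<∣q∣ (p∩q⊆p B (image csucᵖ B) , first)
    where
    descend : ∀ v x → toℕ x ≡ v → x ∈ B → ∃[ z ] (z ∈ B × z ∉ B ∩ image csucᵖ B)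
    descend zero x x≡0 x∈B = ⊥-elim (𝟘∉B (subst (_∈ B) (toℕ-injective (trans x≡0 (sym (toℕ-fromℕ< 0<K)))) x∈B))
    descend (suc v) x x≡v+1 x∈B with cpred x ∈? B
    ... | yes x-1∈B = descend v (cpred x) (toℕ-cpred x≡v+1) x-1∈B
    ... | no x-1∉B = x , x∈B , λ x∈ → x-1∉B (∈-image⁻ csucᵖ (proj₂ (x∈p∩q⁻ B _ x∈)))
    first = descend (toℕ y) y refl y∈B

  toℕ-𝟘 : toℕ 𝟘 ≡ 0
  toℕ-𝟘 = toℕ-fromℕ< 0<K

  module Nondegenerate (2≤n : 2 ≤ n) where

    4≤K : 4 ≤ K
    4≤K = +-mono-≤ 2≤n (≤-trans 2≤n (m≤m+n n 0))

    toℕ-𝟙 : toℕ 𝟙 ≡ 1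
    toℕ-𝟙 = toℕ-iter-csuc 1 (<-≤-trans (s≤s (s≤s z≤n)) 4≤K)

    toℕ-𝟚 : toℕ 𝟚 ≡ 2
    toℕ-𝟚 = toℕ-iter-csuc 2 (<-≤-trans (s≤s (s≤s (s≤s z≤n))) 4≤K)

    csuc≢cpred : ∀ x → csuc x ≢ cpred x
    csuc≢cpred x csuc≡cpred = cases (isNext-csuc x) (subst (IsNext (csuc x)) csuc²≡ (isNext-csuc (csuc x)))
      where
      csuc²≡ : csuc (csuc x) ≡ x
      csuc²≡ = trans (cong csuc csuc≡cpred) (csuc-cpred x)
      K≢ : ∀ {m} → m < 4 → m ≢ K
      K≢ m<4 m≡K = <-irrefl m≡K (<-≤-trans m<4 4≤K)
      cases : IsNext x (csuc x) → IsNext (csuc x) x → ⊥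
      cases (inj₁ x+1≡y) (inj₁ y+1≡x) = <-irrefl (sym (trans (cong suc x+1≡y) y+1≡x)) (ℕ.≤-trans (ℕ.n<1+n (toℕ x)) (n≤1+n _))
      cases (inj₁ x+1≡y) (inj₂ (y+1≡K , x≡0)) = K≢ (s≤s (s≤s (s≤s z≤n))) (trans (cong (2 +_) (sym x≡0)) (trans (cong suc x+1≡y) y+1≡K))
      cases (inj₂ (x+1≡K , y≡0)) (inj₁ y+1≡x) = K≢ (s≤s (s≤s (s≤s z≤n))) (trans (cong (2 +_) (sym y≡0)) (trans (cong suc y+1≡x) x+1≡K))
      cases (inj₂ (_ , y≡0)) (inj₂ (y+1≡K , _)) = K≢ (s≤s (s≤s z≤n)) (trans (cong suc (sym y≡0)) y+1≡K)

    csuc²≢ : ∀ x → csuc² x ≢ x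
    csuc²≢ x csuc²x≡x = csuc≢cpred x (trans (sym (cpred-csuc (csuc x))) (cong cpred csuc²x≡x))

    module _ (B : Subset K) where

      private
        B! : Fin K → Bool
        B! = lookup B

        up down : Fin K → ℕ
        up a = b2n (B! a ∧ B! (csuc a) ∧ even a)
        down a = b2n (B! a ∧ B! (cpred a) ∧ even a)

        split : ∀ p q e u v → (u ≡ true → v ≡ false) →
          b2n (p ∧ q ∧ (e ∧ (u ∨ v))) ≡ b2n (p ∧ q ∧ (e ∧ u)) + b2n (p ∧ q ∧ (e ∧ v))
        split true true true true v u⇒¬v rewrite u⇒¬v refl = refl
        split true true true false v _ = refl
        split true true false u v _ = refl
        split true false e u v _ = refl
        split false q e u v _ = refl

        toward : ∀ a c → ∑[ b < K ] b2n (B! a ∧ B! b ∧ (even a ∧ ⌊ b ≟ c ⌋)) ≡ b2n (B! a ∧ B! c ∧ even a)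
        toward a c = trans (∑-single _ c elsewhere) (cong (λ z → b2n (B! a ∧ B! c ∧ z)) (trans (cong (even a ∧_) (≟-refl c)) (∧-identityʳ (even a))))
          where
          elsewhere : ∀ b → b ≢ c → b2n (B! a ∧ B! b ∧ (even a ∧ ⌊ b ≟ c ⌋)) ≡ 0
          elsewhere b b≢c rewrite ≟-≢ b≢c with B! a | B! b | even a
          ... | true | true | true = refl
          ... | true | true | false = refl
          ... | true | false | _ = refl
          ... | false | _ | _ = refl

        out-edges : ∀ a → ∑[ b < K ] b2n (B! a ∧ B! b ∧ lt (gon n) a b) ≡ up a + down a
        out-edges a = begin
          ∑[ b < K ] b2n (B! a ∧ B! b ∧ lt (gon n) a b)                 ≡⟨ ∑-cong split-at ⟩
          ∑[ b < K ] (toCsuc b + toCpred b)                             ≡⟨ ∑-distrib-+ toCsuc toCpred ⟩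
          ∑[ b < K ] toCsuc b + ∑[ b < K ] toCpred b                    ≡⟨ cong₂ _+_ (toward a (csuc a)) (toward a (cpred a)) ⟩
          up a + down a                                                 ∎
          where
          open ≡-Reasoning
          toCsuc toCpred : Fin K → ℕ
          toCsuc b = b2n (B! a ∧ B! b ∧ (even a ∧ ⌊ b ≟ csuc a ⌋))
          toCpred b = b2n (B! a ∧ B! b ∧ (even a ∧ ⌊ b ≟ cpred a ⌋))
          exclusive : ∀ b → ⌊ b ≟ csuc a ⌋ ≡ true → ⌊ b ≟ cpred a ⌋ ≡ false
          exclusive b b≟ = ≟-≢ (λ b≡cpred → csuc≢cpred a (trans (sym (≟-true⁻ b≟)) b≡cpred))
          split-at : ∀ b → b2n (B! a ∧ B! b ∧ lt (gon n) a b) ≡ toCsuc b + toCpred b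
          split-at b = trans (cong (λ z → b2n (B! a ∧ B! b ∧ z)) (lt-gon a b))
                             (split (B! a) (B! b) (even a) ⌊ b ≟ csuc a ⌋ ⌊ b ≟ cpred a ⌋ (exclusive b))

        edge : ∀ x → up (cpred x) + down x ≡ b2n (B! x ∧ B! (cpred x))
        edge x rewrite csuc-cpred x | even-cpred x with B! x | B! (cpred x) | even x
        ... | true | true | true = refl
        ... | true | true | false = refl
        ... | true | false | _ = refl
        ... | false | true | _ = refl
        ... | false | false | _ = refl

      -- The strict relations of the 2n-gon are its edges, each counted once at its even end.
      ordCount-gon : ordCount (gon n) B ≡ ∣ B ∩ image csucᵖ B ∣
      ordCount-gon = begin
        ordCount (gon n) B                                                  ≡⟨ ordCount≡∑ (gon n) B ⟩
        ∑[ a < K ] ∑[ b < K ] b2n (B! a ∧ B! b ∧ lt (gon n) a b)             ≡⟨ ∑-cong out-edges ⟩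
        ∑[ a < K ] (up a + down a)                                          ≡⟨ ∑-distrib-+ up down ⟩
        ∑[ a < K ] up a + ∑[ a < K ] down a                                 ≡⟨ cong (_+ ∑[ a < K ] down a) (sum-permute up (flip csucᵖ)) ⟩
        ∑[ x < K ] up (cpred x) + ∑[ x < K ] down x                         ≡⟨ sym (∑-distrib-+ (λ x → up (cpred x)) down) ⟩
        ∑[ x < K ] (up (cpred x) + down x)                                  ≡⟨ ∑-cong edge ⟩
        ∑[ x < K ] b2n (B! x ∧ B! (cpred x))                                 ≡⟨ ∑-cong (λ x → cong b2n (sym (lookup-edges x))) ⟩
        ∑[ x < K ] b2n (lookup (B ∩ image csucᵖ B) x)                       ≡⟨ sym (∣p∣≡∑ (B ∩ image csucᵖ B)) ⟩
        ∣ B ∩ image csucᵖ B ∣                                                ∎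
        where
        open ≡-Reasoning
        lookup-edges : ∀ x → lookup (B ∩ image csucᵖ B) x ≡ (B! x ∧ B! (cpred x))
        lookup-edges x = trans (lookup-zipWith _∧_ x B (image csucᵖ B)) (cong (B! x ∧_) (lookup-image csucᵖ B x))

-- The mirror as a fence generator

module Mirror (n : ℕ) .{{_ : NonZero n}} (3≤n : 3 ≤ n) where
  open Polygon n

  2≤n : 2 ≤ n
  2≤n = ≤-trans (n≤1+n 2) 3≤n

  open Nondegenerate 2≤n

  K≡n+n : K ≡ n + n
  K≡n+n = cong (n +_) (+-identityʳ n)

  n≤K : n ≤ K
  n≤K = m≤m+n n (n + 0)


  interval : Subset K
  interval = tabulate (λ x → ⌊ 1 ℕ.≤? toℕ x ⌋ ∧ ⌊ toℕ x ℕ.<? n ⌋)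

  ∈-interval⁺ : ∀ {x : Fin K} → 1 ≤ toℕ x → toℕ x < n → x ∈ interval
  ∈-interval⁺ {x} 1≤x x<n = lookup⇒[]= x interval
    (trans (lookup∘tabulate _ x) (cong₂ _∧_ (⌊⌋-true⁺ (1 ℕ.≤? toℕ x) 1≤x) (⌊⌋-true⁺ (toℕ x ℕ.<? n) x<n)))

  ∈-interval⁻ : ∀ {x : Fin K} → x ∈ interval → 1 ≤ toℕ x × toℕ x < n
  ∈-interval⁻ {x} x∈ with ∧-true⁻ {⌊ 1 ℕ.≤? toℕ x ⌋} (trans (sym (lookup∘tabulate _ x)) ([]=⇒lookup x∈))
  ... | 1≤x , x<n = ⌊⌋-true⁻ (1 ℕ.≤? toℕ x) 1≤x , ⌊⌋-true⁻ (toℕ x ℕ.<? n) x<n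

  private
    below-half : ∀ {x y : Fin K} → toℕ x < n → toℕ y < n → toℕ x + toℕ y ≢ K
    below-half x<n y<n x+y≡K = <-irrefl (trans x+y≡K K≡n+n) (+-mono-< x<n y<n)

    𝟙∈interval : 𝟙 ∈ interval
    𝟙∈interval = ∈-interval⁺ (≤-reflexive (sym toℕ-𝟙)) (subst (_< n) (sym toℕ-𝟙) 2≤n)

    𝟚∈interval : 𝟚 ∈ interval
    𝟚∈interval = ∈-interval⁺ (subst (1 ≤_) (sym toℕ-𝟚) (s≤s z≤n)) (subst (_< n) (sym toℕ-𝟚) 3≤n)

    interval⊆support : interval ⊆ support mirrorᵖ
    interval⊆support {x} x∈ = ∈-support⁺ mirrorᵖ λ mirror-x≡x →
      below-half x<n x<n (trans (cong (λ y → toℕ y + toℕ x) (sym mirror-x≡x)) (mirror-+ 1≤x))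
      where
      1≤x = proj₁ (∈-interval⁻ x∈)
      x<n = proj₂ (∈-interval⁻ x∈)

    𝟘∉support : 𝟘 ∉ support mirrorᵖ
    𝟘∉support 𝟘∈ = ∈-support⁻ mirrorᵖ 𝟘∈ mirror-𝟘

    interval-edges : interval ⊆ (interval ∩ image csucᵖ interval) ∪ ⁅ 𝟙 ⁆
    interval-edges {x} x∈ with x ≟ 𝟙
    ... | yes x≡𝟙 = x∈p∪q⁺ (inj₂ (subst (_∈ ⁅ 𝟙 ⁆) (sym x≡𝟙) (x∈⁅x⁆ 𝟙)))
    ... | no x≢𝟙 with toℕ x in x≡ | ∈-interval⁻ x∈
    ...   | suc zero | _ = ⊥-elim (x≢𝟙 (toℕ-injective (trans x≡ (sym toℕ-𝟙))))
    ...   | suc (suc v) | _ , x<n =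
      x∈p∪q⁺ (inj₁ (x∈p∩q⁺ (x∈ , ∈-image⁺ csucᵖ (∈-interval⁺ (subst (1 ≤_) (sym (toℕ-cpred x≡)) (s≤s z≤n))
                                                            (subst (_< n) (sym (toℕ-cpred x≡)) (≤-trans (n≤1+n _) x<n))))))

  ∣interval∣≤ordCount+1 : ∣ interval ∣ ≤ ordCount (gon n) interval + 1
  ∣interval∣≤ordCount+1 = begin
    ∣ interval ∣                                                  ≤⟨ p⊆q⇒∣p∣≤∣q∣ interval-edges ⟩
    ∣ (interval ∩ image csucᵖ interval) ∪ ⁅ 𝟙 ⁆ ∣                 ≤⟨ ∣p∪q∣≤∣p∣+∣q∣ (interval ∩ image csucᵖ interval) ⁅ 𝟙 ⁆ ⟩
    ∣ interval ∩ image csucᵖ interval ∣ + ∣ ⁅ 𝟙 ⁆ ∣               ≡⟨ cong₂ _+_ (sym (ordCount-gon interval)) (∣⁅x⁆∣≡1 𝟙) ⟩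
    ordCount (gon n) interval + 1                                 ∎
    where open ℕ.≤-Reasoning

  interval-maxOrdered : MaxOrdered (gon n) (support mirrorᵖ) interval
  interval-maxOrdered = interval⊆support , λ B B⊆Σ ∣B∣≡ → ≤-pred (begin-strict
    ordCount (gon n) B                     ≡⟨ ordCount-gon B ⟩
    ∣ B ∩ image csucᵖ B ∣                  <⟨ edges-path-bound B (λ 𝟘∈B → 𝟘∉support (B⊆Σ 𝟘∈B)) (nonempty B ∣B∣≡) ⟩
    ∣ B ∣                                  ≡⟨ ∣B∣≡ ⟩
    ∣ interval ∣                           ≤⟨ ∣interval∣≤ordCount+1 ⟩
    ordCount (gon n) interval + 1          ≡⟨ +-comm _ 1 ⟩
    suc (ordCount (gon n) interval)        ∎)
    where
    open ℕ.≤-Reasoning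
    nonempty : ∀ B → ∣ B ∣ ≡ ∣ interval ∣ → Nonempty B
    nonempty B ∣B∣≡ with nonempty? B
    ... | yes ne = ne
    ... | no empty = ⊥-elim (<-irrefl (trans (sym (Empty⇒∣p∣≡0 empty)) ∣B∣≡) 1≤∣interval∣)
      where
      1≤∣interval∣ : 1 ≤ ∣ interval ∣
      1≤∣interval∣ = ≤-trans (≤-reflexive (sym (∣⁅x⁆∣≡1 𝟙))) (p⊆q⇒∣p∣≤∣q∣ λ y∈ → subst (_∈ interval) (sym (x∈⁅y⁆⇒x≡y 𝟙 y∈)) 𝟙∈interval)

  private
    even-𝟚 : even 𝟚 ≡ true
    even-𝟚 = cong isEven toℕ-𝟚

    𝟚𝟙-chain : IsChain (gon n) (⁅ 𝟚 ⁆ ∪ ⁅ 𝟙 ⁆)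
    𝟚𝟙-chain = pair-chain (gon-refl 𝟚) (gon-refl 𝟙)
      (lt⇒≤ (gon n) 𝟚 𝟙 (subst (λ y → lt (gon n) 𝟚 y ≡ true) (cpred-csuc 𝟙) (lt-cpred 𝟚 even-𝟚)))

    ∣𝟚𝟙∣ : ∣ ⁅ 𝟚 ⁆ ∪ ⁅ 𝟙 ⁆ ∣ ≡ 2
    ∣𝟚𝟙∣ = ∣⁅x⁆∪⁅y⁆∣≡2 (λ 𝟚≡𝟙 → csuc≢ 𝟙 𝟚≡𝟙)

    height-2 : ∀ {S} → interval ⊆ S → Height (gon n) S 2
    height-2 interval⊆S = (⁅ 𝟚 ⁆ ∪ ⁅ 𝟙 ⁆ , ⊆S , 𝟚𝟙-chain , ∣𝟚𝟙∣) , λ C _ chain → ∣chain∣≤2 C chain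
      where
      ⊆S : ⁅ 𝟚 ⁆ ∪ ⁅ 𝟙 ⁆ ⊆ _
      ⊆S y∈ with x∈p∪q⁻ ⁅ 𝟚 ⁆ ⁅ 𝟙 ⁆ y∈
      ... | inj₁ y∈𝟚 = interval⊆S (subst (_∈ interval) (sym (x∈⁅y⁆⇒x≡y 𝟚 y∈𝟚)) 𝟚∈interval)
      ... | inj₂ y∈𝟙 = interval⊆S (subst (_∈ interval) (sym (x∈⁅y⁆⇒x≡y 𝟙 y∈𝟙)) 𝟙∈interval)

    support-cover : support mirrorᵖ ⊆ interval ∪ image mirrorᵖ interval
    support-cover {p} p∈ = cover (<-cmp (toℕ p) n)
      where
      1≤p : 1 ≤ toℕ p
      1≤p = ℕ.n≢0⇒n>0 λ p≡0 → 𝟘∉support (subst (_∈ support mirrorᵖ) (toℕ-injective (trans p≡0 (sym (toℕ-fromℕ< 0<K)))) p∈)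
      mp+p≡n+n : toℕ (mirror p) + toℕ p ≡ n + n
      mp+p≡n+n = trans (mirror-+ 1≤p) K≡n+n
      cover : Tri (toℕ p < n) (toℕ p ≡ n) (n < toℕ p) → p ∈ interval ∪ image mirrorᵖ interval
      cover (tri< p<n _ _) = x∈p∪q⁺ (inj₁ (∈-interval⁺ 1≤p p<n))
      cover (tri≈ _ p≡n _) = ⊥-elim (∈-support⁻ mirrorᵖ p∈ (toℕ-injective (+-cancelʳ-≡ (toℕ p) _ _
        (trans mp+p≡n+n (cong₂ _+_ (sym p≡n) (sym p≡n))))))
      cover (tri> _ _ n<p) = x∈p∪q⁺ (inj₂ (∈-image⁺ mirrorᵖ (∈-interval⁺ 1≤mp mp<n)))
        where
        mp<n : toℕ (mirror p) < n
        mp<n with toℕ (mirror p) ℕ.<? n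
        ... | yes mp<n = mp<n
        ... | no mp≮n = ⊥-elim (<-irrefl (sym mp+p≡n+n) (ℕ.+-mono-≤-< (ℕ.≮⇒≥ mp≮n) n<p))
        1≤mp : 1 ≤ toℕ (mirror p)
        1≤mp = ℕ.n≢0⇒n>0 λ mp≡0 → <-irrefl (trans (sym (cong (_+ toℕ p) mp≡0)) (mirror-+ 1≤p)) (toℕ<n p)

    disjoint : Empty (interval ∩ image mirrorᵖ interval)
    disjoint (x , x∈) with x∈p∩q⁻ interval (image mirrorᵖ interval) x∈
    ... | x∈I , x∈mI with ∈-interval⁻ x∈I | ∈-interval⁻ (∈-image⁻ mirrorᵖ x∈mI)
    ...   | 1≤x , x<n | _ , mx<n = below-half mx<n x<n (mirror-+ 1≤x)

  interval-fence : SubIso (gon n) interval (fence (n ∸ 1) false)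
  interval-fence = e , e-injective , e∈ , onto , order
    where
    <∸1⇒suc< : ∀ {a m} → a < m ∸ 1 → suc a < m
    <∸1⇒suc< {m = suc m} a<m = s≤s a<m
    suc<⇒<∸1 : ∀ {a m} → suc a < m → a < m ∸ 1
    suc<⇒<∸1 {m = suc m} (s≤s a<m) = a<m
    suc<n : ∀ (i : Fin (n ∸ 1)) → suc (toℕ i) < n
    suc<n i = <∸1⇒suc< (toℕ<n i)
    suc<K : ∀ (i : Fin (n ∸ 1)) → suc (toℕ i) < K
    suc<K i = ≤-trans (suc<n i) n≤K
    e : Fin (n ∸ 1) → Fin K
    e i = fromℕ< (suc<K i)
    toℕ-e : ∀ i → toℕ (e i) ≡ suc (toℕ i)
    toℕ-e i = toℕ-fromℕ< (suc<K i)
    e-injective : ∀ {i j} → e i ≡ e j → i ≡ j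
    e-injective {i} {j} ei≡ej = toℕ-injective (ℕ.suc-injective (trans (sym (toℕ-e i)) (trans (cong toℕ ei≡ej) (toℕ-e j))))
    e∈ : ∀ i → e i ∈ interval
    e∈ i = ∈-interval⁺ (subst (1 ≤_) (sym (toℕ-e i)) (s≤s z≤n)) (subst (_< n) (sym (toℕ-e i)) (suc<n i))
    onto : ∀ p → p ∈ interval → ∃[ i ] e i ≡ p
    onto p p∈ with toℕ p in p≡ | ∈-interval⁻ p∈
    ... | suc y | _ , p<n = fromℕ< (suc<⇒<∸1 p<n) , toℕ-injective (trans (toℕ-e _) (trans (cong suc (toℕ-fromℕ< _)) (sym p≡)))
    order : ∀ i j → gon n (e i) (e j) ≡ fence (n ∸ 1) false i j
    order i j rewrite toℕ-e i | toℕ-e j =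
      cong₂ _∨_ (≟-injective e e-injective i j)
                (cong₂ _∧_ (isEven-suc (toℕ i)) (cong ((suc (toℕ i) ≡ᵇ toℕ j) ∨_) (∨-identityʳ (suc (toℕ j) ≡ᵇ toℕ i))))

  mirror-generator : GeneratorFamily (gon n) (fence (n ∸ 1) false) 2 mirrorᵖ (orbit mirrorᵖ interval)
  mirror-generator = involution-generator mirrorᵖ mirror-aut mirror-involutive interval
    interval-maxOrdered (2 , height-2 (λ x∈ → x∈) , height-2 interval⊆support) support-cover disjoint interval-fence

quarter-class : ℕ → Fin 3
quarter-class 0 = zero
quarter-class 1 = suc (suc zero)
quarter-class 2 = suc zero
quarter-class 3 = suc (suc zero)
quarter-class (suc (suc (suc (suc v)))) = quarter-class v

parity-class : ℕ → Fin 2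
parity-class 0 = zero
parity-class 1 = suc zero
parity-class (suc (suc v)) = parity-class v

module Fibres (n : ℕ) .{{_ : NonZero n}} {ℓ : Level} {_≈_ : Rel (Fin (2 * n)) ℓ} (≈-equiv : IsEquivalence _≈_)
              (≈-csuc⁴ : ∀ x → x ≈ Polygon.csuc² n (Polygon.csuc² n x)) (𝟙≈𝟛 : Polygon.𝟙 n ≈ Polygon.𝟛 n) where
  open Polygon n
  open IsEquivalence ≈-equiv renaming (refl to ≈-refl; sym to ≈-sym; trans to ≈-trans)

  private
    class-fibres : ∀ {m} (class : ℕ → Fin m) (rep : Fin m → Fin K) → (∀ v → rep (class v) ≈ iter v csuc 𝟘) →
                   ∀ a b → class (toℕ a) ≡ class (toℕ b) → a ≈ b
    class-fibres class rep rep≈ a b same = ≈-trans (≈-sym (≈-at a)) (subst (λ c → rep c ≈ b) (sym same) (≈-at b))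
      where
      ≈-at : ∀ x → rep (class (toℕ x)) ≈ x
      ≈-at x = subst (rep (class (toℕ x)) ≈_) (iter-csuc-toℕ x) (rep≈ (toℕ x))

    quarter-rep : Fin 3 → Fin K
    quarter-rep zero = 𝟘
    quarter-rep (suc zero) = 𝟚
    quarter-rep (suc (suc zero)) = 𝟙

    quarter-rep≈ : ∀ v → quarter-rep (quarter-class v) ≈ iter v csuc 𝟘
    quarter-rep≈ 0 = ≈-refl
    quarter-rep≈ 1 = ≈-refl
    quarter-rep≈ 2 = ≈-refl
    quarter-rep≈ 3 = 𝟙≈𝟛
    quarter-rep≈ (suc (suc (suc (suc v)))) = ≈-trans (quarter-rep≈ v) (≈-csuc⁴ _)

  quarter-fibres : ∀ a b → quarter-class (toℕ a) ≡ quarter-class (toℕ b) → a ≈ b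
  quarter-fibres = class-fibres quarter-class quarter-rep quarter-rep≈

  module _ (𝟘≈𝟚 : 𝟘 ≈ 𝟚) where

    private
      parity-rep : Fin 2 → Fin K
      parity-rep zero = 𝟘
      parity-rep (suc zero) = 𝟙

      parity-rep≈ : ∀ v → parity-rep (parity-class v) ≈ iter v csuc 𝟘
      parity-rep≈ 0 = ≈-refl
      parity-rep≈ 1 = ≈-refl
      parity-rep≈ 2 = 𝟘≈𝟚
      parity-rep≈ 3 = 𝟙≈𝟛
      parity-rep≈ (suc (suc (suc (suc v)))) = ≈-trans (parity-rep≈ v) (≈-csuc⁴ _)

    parity-fibres : ∀ a b → parity-class (toℕ a) ≡ parity-class (toℕ b) → a ≈ b
    parity-fibres = class-fibres parity-class parity-rep parity-rep≈

module MirrorSymmetry (n : ℕ) .{{_ : NonZero n}} (3≤n : 3 ≤ n) where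
  open Polygon n
  open Mirror n 3≤n

  _~_ : Fin K → Fin K → Set
  _~_ = Sym (gon n) (fence (n ∸ 1) false) 2

  ~-equiv : IsEquivalence _~_
  ~-equiv = isEquivalence _

  -- x ↦ 4 − x, the mirror conjugated by the rotation by two
  mirror₄ : Fin K → Fin K
  mirror₄ = csuc² ∘ mirror ∘ cpred²

  private
    cpred²-csuc² : ∀ x → cpred² (csuc² x) ≡ x
    cpred²-csuc² x = trans (cong cpred (cpred-csuc (csuc x))) (cpred-csuc x)

    mirror₄-involutive : ∀ x → mirror₄ (mirror₄ x) ≡ x
    mirror₄-involutive x = begin
      csuc² (mirror (cpred² (csuc² (mirror (cpred² x)))))   ≡⟨ cong (csuc² ∘ mirror) (cpred²-csuc² (mirror (cpred² x))) ⟩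
      csuc² (mirror (mirror (cpred² x)))                    ≡⟨ cong csuc² (mirror-involutive (cpred² x)) ⟩
      csuc² (cpred² x)                                      ≡⟨ inverseʳ rotate₂ ⟩
      x                                                     ∎
      where open ≡-Reasoning

  mirror₄ᵖ : Permutation′ K
  mirror₄ᵖ = permutation mirror₄ mirror₄ mirror₄-involutive mirror₄-involutive

  ~mirror : ∀ x → x ~ mirror x
  ~mirror = Sym-step mirrorᵖ (orbit mirrorᵖ interval) mirror-generator

  ~mirror₄ : ∀ x → x ~ mirror₄ x
  ~mirror₄ = Sym-step mirror₄ᵖ (image rotate₂ ∘ orbit mirrorᵖ interval)
    (generatorFamily-conj {τ = rotate₂} {mirrorᵖ} {mirror₄ᵖ} rotate₂-aut (λ x → cong (csuc² ∘ mirror) (cpred²-csuc² x)) mirror-generator)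

  ~csuc⁴ : ∀ x → x ~ csuc² (csuc² x)
  ~csuc⁴ x = transitive _ (~mirror x) (subst (mirror x ~_) mirror₄-mirror (~mirror₄ (mirror x)))
    where
    mirror₄-mirror : mirror₄ (mirror x) ≡ csuc² (csuc² x)
    mirror₄-mirror = begin
      csuc² (mirror (cpred (cpred (mirror x))))      ≡⟨ cong csuc² (mirror-cpred (cpred (mirror x))) ⟩
      csuc² (csuc (mirror (cpred (mirror x))))       ≡⟨ cong (csuc² ∘ csuc) (mirror-cpred (mirror x)) ⟩
      csuc² (csuc (csuc (mirror (mirror x))))        ≡⟨ cong (csuc² ∘ csuc²) (mirror-involutive x) ⟩
      csuc² (csuc² x)                                ∎
      where open ≡-Reasoning


  𝟙~𝟛 : 𝟙 ~ 𝟛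
  𝟙~𝟛 = subst (𝟙 ~_) mirror₄-𝟙 (~mirror₄ 𝟙)
    where
    mirror₄-𝟙 : mirror₄ 𝟙 ≡ 𝟛
    mirror₄-𝟙 = begin
      csuc² (mirror (cpred (cpred (csuc 𝟘))))   ≡⟨ cong (csuc² ∘ mirror ∘ cpred) (cpred-csuc 𝟘) ⟩
      csuc² (mirror (cpred 𝟘))                  ≡⟨ cong csuc² (mirror-cpred 𝟘) ⟩
      csuc² (csuc (mirror 𝟘))                   ≡⟨ cong (csuc² ∘ csuc) mirror-𝟘 ⟩
      𝟛                                         ∎
      where open ≡-Reasoning

-- Invariants of automorphisms and generators

parity-class-isEven : ∀ v → parity-class v ≡ (if isEven v then zero else suc zero)
parity-class-isEven 0 = refl
parity-class-isEven 1 = refl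
parity-class-isEven (suc (suc v)) = parity-class-isEven v

-- the second binary digit: on even numbers it separates 0 and 2 (mod 4)
bit₁ : ℕ → Bool
bit₁ 0 = false
bit₁ 1 = false
bit₁ (suc (suc v)) = not (bit₁ v)

bit₁-*4 : ∀ t → bit₁ (t * 4) ≡ false
bit₁-*4 zero = refl
bit₁-*4 (suc t) = trans (not-involutive (bit₁ (t * 4))) (bit₁-*4 t)

bit₁-1+*4 : ∀ t → bit₁ (suc (t * 4)) ≡ false
bit₁-1+*4 zero = refl
bit₁-1+*4 (suc t) = trans (not-involutive (bit₁ (suc (t * 4)))) (bit₁-1+*4 t)

quarter-class-even : ∀ v → isEven v ≡ true → quarter-class v ≡ (if bit₁ v then suc zero else zero)
quarter-class-even 0 _ = refl
quarter-class-even 2 _ = refl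
quarter-class-even (suc (suc (suc (suc v)))) even-v rewrite not-involutive (bit₁ v) = quarter-class-even v even-v

quarter-class-odd : ∀ v → isEven v ≡ false → quarter-class v ≡ suc (suc zero)
quarter-class-odd 1 _ = refl
quarter-class-odd 3 _ = refl
quarter-class-odd (suc (suc (suc (suc v)))) odd-v = quarter-class-odd v odd-v

quarter-class-*4 : ∀ t → quarter-class (t * 4) ≡ zero
quarter-class-*4 zero = refl
quarter-class-*4 (suc t) = quarter-class-*4 t

module Invariants (n : ℕ) .{{_ : NonZero n}} where
  open Polygon n

  parity : Fin K → Fin 2
  parity x = parity-class (toℕ x)

  quarter : Fin K → Fin 3
  quarter x = quarter-class (toℕ x)

  parity-aut : ∀ {σ} → IsAut (gon n) σ → ∀ x → parity (σ ⟨$⟩ʳ x) ≡ parity x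
  parity-aut {σ} aut x = begin
    parity-class (toℕ (σ ⟨$⟩ʳ x))                    ≡⟨ parity-class-isEven (toℕ (σ ⟨$⟩ʳ x)) ⟩
    (if even (σ ⟨$⟩ʳ x) then zero else suc zero)     ≡⟨ cong (if_then zero else suc zero) (even-aut σ aut x) ⟩
    (if even x then zero else suc zero)              ≡⟨ sym (parity-class-isEven (toℕ x)) ⟩
    parity-class (toℕ x)                             ∎
    where open ≡-Reasoning

  module _ (t : ℕ) (K≡t*4 : K ≡ t * 4) where

    bit₁-csuc² : ∀ z → bit₁ (toℕ (csuc² z)) ≡ not (bit₁ (toℕ z))
    bit₁-csuc² z with isNext-csuc z | isNext-csuc (csuc z)
    ... | inj₁ z→y | inj₁ y→w = cong bit₁ (sym (trans (cong suc z→y) y→w))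
    ... | inj₁ z→y | inj₂ (y+1≡K , w≡0) =
      trans (cong bit₁ w≡0) (sym (trans (cong bit₁ (trans (cong suc z→y) (trans y+1≡K K≡t*4))) (bit₁-*4 t)))
    ... | inj₂ (z+1≡K , y≡0) | inj₁ y→w =
      trans (cong bit₁ (trans (sym y→w) (cong suc y≡0))) (sym (trans (cong (bit₁ ∘ (1 +_)) (trans z+1≡K K≡t*4)) (bit₁-1+*4 t)))
    ... | inj₂ (_ , y≡0) | inj₂ (y+1≡K , _) =
      ⊥-elim (true≢false (trans (sym (isEven-2* n)) (cong isEven (sym (trans (cong suc (sym y≡0)) y+1≡K)))))

    bit₁-cpred² : ∀ z → bit₁ (toℕ (cpred² z)) ≡ not (bit₁ (toℕ z))
    bit₁-cpred² z = sym (trans (cong (not ∘ bit₁ ∘ toℕ) (sym (csuc²-cpred² z))) (trans (cong not (bit₁-csuc² (cpred² z))) (not-involutive _)))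
      where
      csuc²-cpred² : ∀ z → csuc² (cpred² z) ≡ z
      csuc²-cpred² z = trans (cong csuc (csuc-cpred (cpred z))) (csuc-cpred z)

    module _ (2≤n : 2 ≤ n) (σ : Permutation′ K) (aut : IsAut (gon n) σ) where

      private
        Agrees : Fin K → Set
        Agrees y = bit₁ (toℕ (σ ⟨$⟩ʳ y)) ≡ bit₁ (toℕ y)

        returns : ∀ {y} → σ ⟨$⟩ʳ csuc² y ≢ σ ⟨$⟩ʳ y
        returns {y} eq = Nondegenerate.csuc²≢ 2≤n y (⟨$⟩ʳ-injective σ eq)

        σ-csuc² : ∀ y → σ ⟨$⟩ʳ csuc² y ≡ csuc² (σ ⟨$⟩ʳ y) ⊎ σ ⟨$⟩ʳ csuc² y ≡ cpred² (σ ⟨$⟩ʳ y)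
        σ-csuc² y with neighbour-aut σ aut y | neighbour-aut σ aut (csuc y)
        ... | inj₁ σy′≡ | inj₁ σy″≡ = inj₁ (trans σy″≡ (cong csuc σy′≡))
        ... | inj₁ σy′≡ | inj₂ σy″≡ = ⊥-elim (returns (trans σy″≡ (trans (cong cpred σy′≡) (cpred-csuc _))))
        ... | inj₂ σy′≡ | inj₁ σy″≡ = ⊥-elim (returns (trans σy″≡ (trans (cong csuc σy′≡) (csuc-cpred _))))
        ... | inj₂ σy′≡ | inj₂ σy″≡ = inj₂ (trans σy″≡ (cong cpred σy′≡))

        bit₁-σ-csuc² : ∀ y → bit₁ (toℕ (σ ⟨$⟩ʳ csuc² y)) ≡ not (bit₁ (toℕ (σ ⟨$⟩ʳ y)))
        bit₁-σ-csuc² y with σ-csuc² y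
        ... | inj₁ σy″≡ = trans (cong (bit₁ ∘ toℕ) σy″≡) (bit₁-csuc² (σ ⟨$⟩ʳ y))
        ... | inj₂ σy″≡ = trans (cong (bit₁ ∘ toℕ) σy″≡) (bit₁-cpred² (σ ⟨$⟩ʳ y))

        agrees-csuc² : ∀ y → Agrees y → Agrees (csuc² y)
        agrees-csuc² y agrees = trans (bit₁-σ-csuc² y) (trans (cong not agrees) (sym (bit₁-csuc² y)))

        agrees-csuc²⁻ : ∀ y → Agrees (csuc² y) → Agrees y
        agrees-csuc²⁻ y agrees = not-injective (trans (sym (bit₁-σ-csuc² y)) (trans agrees (bit₁-csuc² y)))

        agrees-iter : ∀ v → isEven v ≡ true → (Agrees 𝟘 → Agrees (iter v csuc 𝟘)) × (Agrees (iter v csuc 𝟘) → Agrees 𝟘)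
        agrees-iter zero _ = (λ a → a) , (λ a → a)
        agrees-iter (suc (suc v)) even-v with agrees-iter v even-v
        ... | up , down = (λ a → agrees-csuc² _ (up a)) , (λ a → down (agrees-csuc²⁻ _ a))

        agrees-even : ∀ {x} → even x ≡ true → (Agrees 𝟘 → Agrees x) × (Agrees x → Agrees 𝟘)
        agrees-even {x} even-x = subst (λ y → (Agrees 𝟘 → Agrees y) × (Agrees y → Agrees 𝟘)) (iter-csuc-toℕ x) (agrees-iter (toℕ x) even-x)

      -- σ moves all even points by steps of ±2 together, so agreement at one even point spreads to all.
      quarter-aut : ∀ p → even p ≡ true → σ ⟨$⟩ʳ p ≡ p → ∀ x → quarter (σ ⟨$⟩ʳ x) ≡ quarter x
      quarter-aut p even-p σp≡p x with even x in even-x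
      ... | false = trans (quarter-class-odd (toℕ (σ ⟨$⟩ʳ x)) (trans (even-aut σ aut x) even-x)) (sym (quarter-class-odd (toℕ x) even-x))
      ... | true = begin
        quarter-class (toℕ (σ ⟨$⟩ʳ x))                            ≡⟨ quarter-class-even (toℕ (σ ⟨$⟩ʳ x)) (trans (even-aut σ aut x) even-x) ⟩
        (if bit₁ (toℕ (σ ⟨$⟩ʳ x)) then suc zero else zero)        ≡⟨ cong (if_then suc zero else zero) agrees ⟩
        (if bit₁ (toℕ x) then suc zero else zero)                 ≡⟨ sym (quarter-class-even (toℕ x) even-x) ⟩
        quarter-class (toℕ x)                                     ∎
        where
        open ≡-Reasoning
        agrees : Agrees x
        agrees = proj₁ (agrees-even even-x) (proj₂ (agrees-even even-p) (cong (bit₁ ∘ toℕ) σp≡p))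

-- Fences inside the 2n-gon

Neighbours : ∀ {N} → Fin N → Fin N → Set
Neighbours i j = toℕ j ≡ suc (toℕ i) ⊎ toℕ i ≡ suc (toℕ j)

fence-neighbours : ∀ {N} up {i j : Fin N} → Neighbours i j → fenceMin up i ≡ true → fence N up i j ≡ true
fence-neighbours up {i} {j} i~j i-min = ∨-trueʳ ⌊ i ≟ j ⌋ (cong₂ _∧_ i-min (adjacent i~j))
  where
  adjacent : Neighbours i j → ((suc (toℕ i) ≡ᵇ toℕ j) ∨ (suc (toℕ j) ≡ᵇ toℕ i)) ≡ true
  adjacent (inj₁ j≡i+1) = ∨-trueˡ (suc (toℕ j) ≡ᵇ toℕ i) (≡ᵇ-true⁺ (sym j≡i+1))
  adjacent (inj₂ i≡j+1) = ∨-trueʳ (suc (toℕ i) ≡ᵇ toℕ j) (≡ᵇ-true⁺ (sym i≡j+1))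

isEven-neighbours : ∀ {N} {i j : Fin N} → Neighbours i j → isEven (toℕ j) ≡ not (isEven (toℕ i))
isEven-neighbours {i = i} (inj₁ j≡i+1) = trans (cong isEven j≡i+1) (isEven-suc (toℕ i))
isEven-neighbours {j = j} (inj₂ i≡j+1) = sym (trans (cong not (trans (cong isEven i≡j+1) (isEven-suc (toℕ j)))) (not-involutive _))

fenceMin-neighbours : ∀ {N} up {i j : Fin N} → Neighbours i j → fenceMin up j ≡ not (fenceMin up i)
fenceMin-neighbours true i~j = isEven-neighbours i~j
fenceMin-neighbours false i~j = cong not (isEven-neighbours i~j)

neighbour : ∀ {N} → 2 ≤ N → (i : Fin N) → ∃[ j ] Neighbours i j
neighbour 2≤N i with toℕ i in i≡
... | zero = fromℕ< 2≤N , inj₁ (toℕ-fromℕ< 2≤N)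
... | suc v = fromℕ< v<N , inj₂ (cong suc (sym (toℕ-fromℕ< v<N)))
  where
  v<N = ℕ.<-trans (ℕ.n<1+n v) (subst (_< _) i≡ (toℕ<n i))

neighbours-sym : ∀ {N} {i j : Fin N} → Neighbours i j → Neighbours j i
neighbours-sym (inj₁ j≡i+1) = inj₂ j≡i+1
neighbours-sym (inj₂ i≡j+1) = inj₁ i≡j+1

neighbours-≢ : ∀ {N} {i j : Fin N} → Neighbours i j → i ≢ j
neighbours-≢ (inj₁ j≡i+1) refl = ℕ.1+n≢n (sym j≡i+1)
neighbours-≢ (inj₂ i≡j+1) refl = ℕ.1+n≢n (sym i≡j+1)

count-isEven : ∀ m → ∑[ x < m * 2 ] b2n (isEven (toℕ x)) ≡ m
count-isEven zero = refl
count-isEven (suc m) = cong suc (count-isEven m)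

count-odd : ∀ m → ∑[ x < suc (m * 2) ] b2n (not (isEven (toℕ x))) ≡ m
count-odd zero = refl
count-odd (suc m) = cong suc (count-odd m)

module FenceEmbedding (n : ℕ) .{{_ : NonZero n}} where
  open Polygon n

  module _ {N} up (e : Fin N → Fin K) (e-injective : Injective _≡_ _≡_ e) (e-order : ∀ i j → gon n (e i) (e j) ≡ fence N up i j) where

    private
      lt-neighbours : ∀ {i i′} → Neighbours i i′ → fenceMin up i ≡ true → lt (gon n) (e i) (e i′) ≡ true
      lt-neighbours {i} {i′} i~i′ i-min = cong₂ _∧_ (trans (e-order i i′) (fence-neighbours up i~i′ i-min))
                                                   (cong not (≟-≢ (λ ei≡ei′ → neighbours-≢ i~i′ (e-injective ei≡ei′))))

    fence-embedding-even : 2 ≤ N → ∀ j → even (e j) ≡ fenceMin up j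
    fence-embedding-even 2≤N j with neighbour 2≤N j
    ... | j′ , j~j′ with fenceMin up j in j-min
    ...   | true = proj₁ (lt-parity (e j) (e j′) (lt-neighbours j~j′ j-min))
    ...   | false = proj₂ (lt-parity (e j′) (e j) (lt-neighbours (neighbours-sym j~j′) (trans (fenceMin-neighbours up j~j′) (cong not j-min))))

  ∣∩evens∣ : ∀ {N up S} → SubIso (gon n) S (fence N up) → 2 ≤ N → ∣ S ∩ evens ∣ ≡ ∑[ j < N ] b2n (fenceMin up j)
  ∣∩evens∣ {N} {up} {S} (e , e-injective , e∈S , onto , e-order) 2≤N = begin
    ∣ S ∩ evens ∣                                 ≡⟨ ∣p∣≡∑ (S ∩ evens) ⟩
    ∑[ p < K ] b2n (lookup (S ∩ evens) p)         ≡⟨ ∑-reindex-injective e e-injective (b2n ∘ lookup (S ∩ evens)) covered ⟩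
    ∑[ j < N ] b2n (lookup (S ∩ evens) (e j))     ≡⟨ ∑-cong (λ j → cong b2n (lookup-e j)) ⟩
    ∑[ j < N ] b2n (fenceMin up j)                ∎
    where
    open ≡-Reasoning
    lookup-e : ∀ j → lookup (S ∩ evens) (e j) ≡ fenceMin up j
    lookup-e j = trans (lookup-zipWith _∧_ (e j) S evens)
      (cong₂ _∧_ ([]=⇒lookup (e∈S j)) (trans (lookup∘tabulate even (e j)) (fence-embedding-even up e e-injective e-order 2≤N j)))
    covered : ∀ p → b2n (lookup (S ∩ evens) p) ≢ 0 → ∃[ j ] e j ≡ p
    covered p p∈ with lookup (S ∩ evens) p in p∈S∩E
    ... | true = onto p (proj₁ (x∈p∩q⁻ S evens (lookup⇒[]= p (S ∩ evens) p∈S∩E)))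
    ... | false = ⊥-elim (p∈ refl)

  ∣evens∣ : ∣ evens ∣ ≡ n
  ∣evens∣ = trans (∣p∣≡∑ evens) (trans (∑-cong (λ x → cong b2n (lookup∘tabulate even x)))
                  (subst (λ k → ∑[ x < k ] b2n (isEven (toℕ x)) ≡ n) (ℕ.*-comm n 2) (count-isEven n)))

module FenceGenerator (t : ℕ) where
  open Polygon (4 + t * 2)
  open FenceEmbedding (4 + t * 2)

  -- The two fences of σ contain only 2 (t + 1) < n even points, so σ fixes one.
  fixed-even : ∀ {σ S} → GeneratorFamily (gon (4 + t * 2)) (fence (3 + t * 2) false) 2 σ S → ∃[ p ] (even p ≡ true × σ ⟨$⟩ʳ p ≡ p)
  fixed-even {σ} {S} (_ , _ , (_ , _ , _ , cover) , iso , _) with any? (λ p → (even p Data.Bool.≟ true) ×-dec (σ ⟨$⟩ʳ p ≟ p))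
  ... | yes found = found
  ... | no none = ⊥-elim (ℕ.<-irrefl refl (begin-strict
    4 + t * 2                                                  ≡⟨ sym ∣evens∣ ⟩
    ∣ evens ∣                                                  ≤⟨ p⊆q⇒∣p∣≤∣q∣ evens⊆ ⟩
    ∣ S zero ∩ evens ∪ S (suc zero) ∩ evens ∣                  ≤⟨ ∣p∪q∣≤∣p∣+∣q∣ (S zero ∩ evens) (S (suc zero) ∩ evens) ⟩
    ∣ S zero ∩ evens ∣ + ∣ S (suc zero) ∩ evens ∣              ≡⟨ cong₂ _+_ (∣S∩evens∣ zero) (∣S∩evens∣ (suc zero)) ⟩
    suc t + suc t                                              ≡⟨ ℕ.+-suc (suc t) t ⟩
    2 + (t + t)                                                ≡⟨ cong (λ m → 2 + (t + m)) (sym (ℕ.+-identityʳ t)) ⟩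
    2 + 2 * t                                                  ≡⟨ cong (2 +_) (ℕ.*-comm 2 t) ⟩
    2 + t * 2                                                  <⟨ ℕ.n≤1+n (3 + t * 2) ⟩
    4 + t * 2                                                  ∎))
    where
    open ℕ.≤-Reasoning
    ∣S∩evens∣ : ∀ i → ∣ S i ∩ evens ∣ ≡ suc t
    ∣S∩evens∣ i = trans (∣∩evens∣ {up = false} (iso i) (s≤s (s≤s z≤n))) (count-odd (suc t))
    evens⊆ : evens ⊆ S zero ∩ evens ∪ S (suc zero) ∩ evens
    evens⊆ {p} p∈E with cover p (∈-support⁺ σ (λ σp≡p → none (p , ∈evens⇒even p∈E , σp≡p)))
    ... | zero , p∈S = x∈p∪q⁺ (inj₁ (x∈p∩q⁺ (p∈S , p∈E)))
    ... | suc zero , p∈S = x∈p∪q⁺ (inj₂ (x∈p∩q⁺ (p∈S , p∈E)))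

-- The retractions

top : Fin 3
top = suc (suc zero)

Λ : FinOrd 3
Λ u v = ⌊ u ≟ v ⌋ ∨ ⌊ v ≟ top ⌋

module Retractions (n : ℕ) .{{_ : NonZero n}} (2≤n : 2 ≤ n) where
  open Polygon n
  open Invariants n
  open Nondegenerate 2≤n

  private
    𝟘≤𝟙 : gon n 𝟘 𝟙 ≡ true
    𝟘≤𝟙 = lt⇒≤ (gon n) 𝟘 𝟙 (lt-csuc 𝟘 (cong isEven toℕ-𝟘))

    𝟚≤𝟙 : gon n 𝟚 𝟙 ≡ true
    𝟚≤𝟙 = lt⇒≤ (gon n) 𝟚 𝟙 (subst (λ y → lt (gon n) 𝟚 y ≡ true) (cpred-csuc 𝟙) (lt-cpred 𝟚 (cong isEven toℕ-𝟚)))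

  parity-chain : chain2 ≐ induced (gon n) parity
  parity-chain zero zero = sym (induced-true (gon n) parity 𝟘 𝟘 (cong parity-class toℕ-𝟘) (cong parity-class toℕ-𝟘) (gon-refl 𝟘))
  parity-chain zero (suc zero) = sym (induced-true (gon n) parity 𝟘 𝟙 (cong parity-class toℕ-𝟘) (cong parity-class toℕ-𝟙) 𝟘≤𝟙)
  parity-chain (suc zero) (suc zero) = sym (induced-true (gon n) parity 𝟙 𝟙 (cong parity-class toℕ-𝟙) (cong parity-class toℕ-𝟙) (gon-refl 𝟙))
  parity-chain (suc zero) zero = sym (induced-false (gon n) parity unrelated)
    where
    unrelated : ∀ a b → parity a ≡ suc zero → parity b ≡ zero → gon n a b ≡ false
    unrelated a b pa pb with gon n a b in a≤b
    ... | false = refl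
    ... | true with ≤-parity a b a≤b
    ...   | inj₁ refl = ⊥-elim (0≢1+n (trans (sym pb) pa))
    ...   | inj₂ (even-a , _) = ⊥-elim (0≢1+n (trans (sym (trans (parity-class-isEven (toℕ a)) (cong (if_then zero else suc zero) even-a))) pa))

  parity-retraction : ∀ {m} (Q : FinOrd m) → (∀ x → Sym (gon n) Q 2 x (csuc² (csuc² x))) →
    Sym (gon n) Q 2 𝟙 𝟛 → Sym (gon n) Q 2 𝟘 𝟚 → IsRetractionMap (gon n) Q 2 parity
  parity-retraction Q ~csuc⁴ 𝟙~𝟛 𝟘~𝟚 =
    retraction-map parity onto (Fibres.parity-fibres n (isEquivalence _) ~csuc⁴ 𝟙~𝟛 𝟘~𝟚) (λ σ S family → parity-aut {σ} (proj₁ family))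
    where
    onto : ∀ y → ∃[ x ] parity x ≡ y
    onto zero = 𝟘 , cong parity-class toℕ-𝟘
    onto (suc zero) = 𝟙 , cong parity-class toℕ-𝟙

  quarter-onto : ∀ y → ∃[ x ] quarter x ≡ y
  quarter-onto zero = 𝟘 , cong quarter-class toℕ-𝟘
  quarter-onto (suc zero) = 𝟚 , cong quarter-class toℕ-𝟚
  quarter-onto (suc (suc zero)) = 𝟙 , cong quarter-class toℕ-𝟙

  private
    Λ-unrelated : ∀ {u v} → Λ u v ≡ false → ∀ a b → quarter a ≡ u → quarter b ≡ v → gon n a b ≡ false
    Λ-unrelated {u} {v} Λuv a b qa qb with gon n a b in a≤b
    ... | false = refl
    ... | true with ≤-parity a b a≤b
    ...   | inj₁ refl = ⊥-elim (true≢false (trans (sym (∨-trueˡ ⌊ v ≟ top ⌋ u≟v)) Λuv))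
      where
      u≟v : ⌊ u ≟ v ⌋ ≡ true
      u≟v = ⌊⌋-true⁺ (u ≟ v) (trans (sym qa) qb)
    ...   | inj₂ (_ , odd-b) = ⊥-elim (true≢false (trans (sym (∨-trueʳ ⌊ u ≟ v ⌋ v≟top)) Λuv))
      where
      v≟top : ⌊ v ≟ top ⌋ ≡ true
      v≟top = ⌊⌋-true⁺ (v ≟ top) (trans (sym qb) (quarter-class-odd (toℕ b) odd-b))

  quarter-Λ : induced (gon n) quarter ≐ Λ
  quarter-Λ zero zero = induced-true (gon n) quarter 𝟘 𝟘 q𝟘 q𝟘 (gon-refl 𝟘)
    where q𝟘 = cong quarter-class toℕ-𝟘
  quarter-Λ (suc zero) (suc zero) = induced-true (gon n) quarter 𝟚 𝟚 q𝟚 q𝟚 (gon-refl 𝟚)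
    where q𝟚 = cong quarter-class toℕ-𝟚
  quarter-Λ (suc (suc zero)) (suc (suc zero)) = induced-true (gon n) quarter 𝟙 𝟙 q𝟙 q𝟙 (gon-refl 𝟙)
    where q𝟙 = cong quarter-class toℕ-𝟙
  quarter-Λ zero (suc (suc zero)) = induced-true (gon n) quarter 𝟘 𝟙 (cong quarter-class toℕ-𝟘) (cong quarter-class toℕ-𝟙) 𝟘≤𝟙
  quarter-Λ (suc zero) (suc (suc zero)) = induced-true (gon n) quarter 𝟚 𝟙 (cong quarter-class toℕ-𝟚) (cong quarter-class toℕ-𝟙) 𝟚≤𝟙
  quarter-Λ zero (suc zero) = induced-false (gon n) quarter (Λ-unrelated refl)
  quarter-Λ (suc zero) zero = induced-false (gon n) quarter (Λ-unrelated refl)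
  quarter-Λ (suc (suc zero)) zero = induced-false (gon n) quarter (Λ-unrelated refl)
  quarter-Λ (suc (suc zero)) (suc zero) = induced-false (gon n) quarter (Λ-unrelated refl)

collapse : Fin 3 → Fin 2
collapse u = if ⌊ u ≟ top ⌋ then suc zero else zero

Λ-top : ∀ σ → IsAut Λ σ → σ ⟨$⟩ʳ top ≡ top
Λ-top σ aut with σ ⟨$⟩ʳ top ≟ top
... | yes σtop≡top = σtop≡top
... | no σtop≢top with ∨-true⁻ {⌊ σ ⟨$⟩ʳ zero ≟ σ ⟨$⟩ʳ top ⌋} (aut zero top)
...   | inj₁ σ0≟σtop with ⟨$⟩ʳ-injective σ (≟-true⁻ σ0≟σtop)
...     | ()
Λ-top σ aut | no σtop≢top | inj₂ σtop≟top = ⊥-elim (σtop≢top (≟-true⁻ σtop≟top))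

collapse-retraction : IsRetractionMap Λ point 2 collapse
collapse-retraction = retraction-map collapse onto fibres invariant
  where
  onto : ∀ y → ∃[ x ] collapse x ≡ y
  onto zero = zero , refl
  onto (suc zero) = top , refl
  0~1 : Sym Λ point 2 zero (suc zero)
  0~1 = Transposition.Sym-transpose {P = Λ} {zero} {suc zero} (λ ()) refl refl refl refl point refl (from-yes (IsAut? Λ (transpose zero (suc zero))))
  fibres : ∀ a b → collapse a ≡ collapse b → Sym Λ point 2 a b
  fibres zero zero _ = reflexive _
  fibres zero (suc zero) _ = 0~1
  fibres (suc zero) zero _ = symmetric _ 0~1
  fibres (suc zero) (suc zero) _ = reflexive _
  fibres (suc (suc zero)) (suc (suc zero)) _ = reflexive _
  fibres zero (suc (suc zero)) ()
  fibres (suc zero) (suc (suc zero)) ()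
  fibres (suc (suc zero)) zero ()
  fibres (suc (suc zero)) (suc zero) ()
  invariant : ∀ σ S → GeneratorFamily Λ point 2 σ S → ∀ x → collapse (σ ⟨$⟩ʳ x) ≡ collapse x
  invariant σ S (aut , _) x = cong (if_then suc zero else zero)
    (trans (cong (λ t → ⌊ σ ⟨$⟩ʳ x ≟ t ⌋) (sym (Λ-top σ aut))) (≟-injective _ (⟨$⟩ʳ-injective σ) x top))

collapse-chain : chain2 ≐ induced Λ collapse
collapse-chain zero zero = refl
collapse-chain zero (suc zero) = refl
collapse-chain (suc zero) zero = refl
collapse-chain (suc zero) (suc zero) = refl

module OddPolygon (t : ℕ) where
  open Polygon (3 + t * 2)
  open Mirror (3 + t * 2) (s≤s (s≤s (s≤s z≤n)))
  open MirrorSymmetry (3 + t * 2) (s≤s (s≤s (s≤s z≤n)))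
  open Invariants (3 + t * 2)
  open Retractions (3 + t * 2) (s≤s (s≤s z≤n))
  open Nondegenerate (s≤s (s≤s z≤n))

  n%2≡1 : (3 + t * 2) % 2 ≡ 1
  n%2≡1 = [m+kn]%n≡m%n 1 t 2

  private
    K≡ : K ≡ suc t * 4 + 2
    K≡ = solve 1 (λ t → con 2 :* (con 3 :+ t :* con 2) := (con 1 :+ t) :* con 4 :+ con 2) refl t
      where open +-*-Solver

    toℕ-mirror-𝟚 : toℕ (mirror 𝟚) ≡ suc t * 4
    toℕ-mirror-𝟚 = ℕ.+-cancelʳ-≡ 2 _ _
      (trans (cong (toℕ (mirror 𝟚) +_) (sym toℕ-𝟚)) (trans (mirror-+ (≤-trans (s≤s z≤n) (≤-reflexive (sym toℕ-𝟚)))) K≡))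

  -- 2 ~ −2 by the mirror, and −2 = 2n − 2 ≡ 0 (mod 4) because n is odd.
  𝟘~𝟚 : 𝟘 ~ 𝟚
  𝟘~𝟚 = transitive _ (Fibres.quarter-fibres (3 + t * 2) ~-equiv ~csuc⁴ 𝟙~𝟛 𝟘 (mirror 𝟚) same-quarter) (symmetric _ (~mirror 𝟚))
    where
    same-quarter : quarter-class (toℕ 𝟘) ≡ quarter-class (toℕ (mirror 𝟚))
    same-quarter = trans (cong quarter-class toℕ-𝟘) (sym (trans (cong quarter-class toℕ-mirror-𝟚) (quarter-class-*4 (suc t))))

  first-retraction : IsRetractionMap (gon (3 + t * 2)) (fence (2 + t * 2) false) 2 parity
  first-retraction = parity-retraction (fence (2 + t * 2) false) ~csuc⁴ 𝟙~𝟛 𝟘~𝟚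

  first-chain : OrdIso (induced (gon (3 + t * 2)) parity) chain2
  first-chain = ≐⇒OrdIso parity-chain

module EvenPolygon (t : ℕ) where
  open Polygon (4 + t * 2)
  open Mirror (4 + t * 2) (s≤s (s≤s (s≤s z≤n)))
  open MirrorSymmetry (4 + t * 2) (s≤s (s≤s (s≤s z≤n)))
  open Invariants (4 + t * 2)
  open Retractions (4 + t * 2) (s≤s (s≤s z≤n))
  open FenceGenerator t

  n%2≡0 : (4 + t * 2) % 2 ≡ 0
  n%2≡0 = [m+kn]%n≡m%n 0 t 2

  private
    K≡ : K ≡ (2 + t) * 4
    K≡ = solve 1 (λ t → con 2 :* (con 4 :+ t :* con 2) := (con 2 :+ t) :* con 4) refl t
      where open +-*-Solver

  first-retraction : IsRetractionMap (gon (4 + t * 2)) (fence (3 + t * 2) false) 2 quarter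
  first-retraction = retraction-map quarter quarter-onto (Fibres.quarter-fibres (4 + t * 2) ~-equiv ~csuc⁴ 𝟙~𝟛) invariant
    where
    invariant : ∀ σ S → GeneratorFamily (gon (4 + t * 2)) (fence (3 + t * 2) false) 2 σ S → ∀ x → quarter (σ ⟨$⟩ʳ x) ≡ quarter x
    invariant σ S family with fixed-even {σ} {S} family
    ... | p , even-p , σp≡p = quarter-aut (2 + t) K≡ (s≤s (s≤s z≤n)) σ (proj₁ family) p even-p σp≡p

  second-retraction : IsRetractionMap (induced (gon (4 + t * 2)) quarter) point 2 collapse
  second-retraction = IsRetractionMap-cong (λ u v → sym (quarter-Λ u v)) collapse-retraction

  second-chain : OrdIso (induced (induced (gon (4 + t * 2)) quarter) collapse) chain2
  second-chain = ≐⇒OrdIso (λ u v → trans (collapse-chain u v) (sym (induced-cong collapse quarter-Λ u v)))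

two-point-rigid : ∀ {P : FinOrd 2} → P zero (suc zero) ≢ P (suc zero) zero → ∀ σ → IsAut P σ → ∀ x → σ ⟨$⟩ʳ x ≡ x
two-point-rigid {P} P01≢P10 σ aut x with σ ⟨$⟩ʳ zero in σ0 | σ ⟨$⟩ʳ suc zero in σ1
... | zero | zero = ⊥-elim (0≢1+n (⟨$⟩ʳ-injective σ (trans σ0 (sym σ1))))
... | suc zero | suc zero = ⊥-elim (0≢1+n (⟨$⟩ʳ-injective σ (trans σ0 (sym σ1))))
... | suc zero | zero = ⊥-elim (P01≢P10 (trans (sym (aut zero (suc zero))) (cong₂ P σ0 σ1)))
... | zero | suc zero with x
...   | zero = σ0
...   | suc zero = σ1

-- For n = 2 the fence is a single point and the generators are the transpositions (1 3) and (0 2).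
module Square where
  open Polygon 2
  open Invariants 2
  open Retractions 2 (s≤s (s≤s z≤n))

  private
    literal : ∀ v (v<4 : v < 4) → iter v csuc 𝟘 ≡ fromℕ< v<4
    literal v v<4 = toℕ-injective (trans (toℕ-iter-csuc v v<4) (sym (toℕ-fromℕ< v<4)))

    csuc⁴-iter : ∀ v → csuc² (csuc² (iter v csuc 𝟘)) ≡ iter v csuc 𝟘
    csuc⁴-iter zero = csuc-unique (inj₂ (cong suc (toℕ-iter-csuc 3 ≤-refl) , toℕ-𝟘))
    csuc⁴-iter (suc v) = cong csuc (csuc⁴-iter v)

    _~_ : Fin 4 → Fin 4 → Set
    _~_ = Sym (gon 2) (fence 1 false) 2

    ~csuc⁴ : ∀ x → x ~ csuc² (csuc² x)
    ~csuc⁴ x = subst (x ~_) (sym csuc⁴x≡x) (reflexive _)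
      where
      csuc⁴x≡x : csuc² (csuc² x) ≡ x
      csuc⁴x≡x = trans (cong (csuc² ∘ csuc²) (sym (iter-csuc-toℕ x))) (trans (csuc⁴-iter (toℕ x)) (iter-csuc-toℕ x))

    𝟙~𝟛 : 𝟙 ~ 𝟛
    𝟙~𝟛 = subst₂ _~_ (sym (literal 1 (s≤s (s≤s z≤n)))) (sym (literal 3 ≤-refl))
      (Transposition.Sym-transpose {P = gon 2} {suc zero} {suc (suc (suc zero))} (λ ()) refl refl refl refl (fence 1 false) refl
        (from-yes (IsAut? (gon 2) (transpose (suc zero) (suc (suc (suc zero)))))))

    𝟘~𝟚 : 𝟘 ~ 𝟚
    𝟘~𝟚 = subst₂ _~_ (sym (literal 0 (s≤s z≤n))) (sym (literal 2 (s≤s (s≤s (s≤s z≤n)))))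
      (Transposition.Sym-transpose {P = gon 2} {zero} {suc (suc zero)} (λ ()) refl refl refl refl (fence 1 false) refl
        (from-yes (IsAut? (gon 2) (transpose zero (suc (suc zero))))))

  first-retraction : IsRetractionMap (gon 2) (fence 1 false) 2 parity
  first-retraction = parity-retraction (fence 1 false) ~csuc⁴ 𝟙~𝟛 𝟘~𝟚

  second-retraction : IsRetractionMap (induced (gon 2) parity) point 2 id
  second-retraction = id-retraction (λ σ S family → two-point-rigid (λ ()) σ (proj₁ family))

  second-chain : OrdIso (induced (induced (gon 2) parity) id) chain2
  second-chain = ≐⇒OrdIso chain
    where
    chain : chain2 ≐ induced (induced (gon 2) parity) id
    chain zero zero = refl
    chain zero (suc zero) = refl
    chain (suc zero) zero = refl
    chain (suc zero) (suc zero) = refl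

data Shape : ℕ → Set where
  two  : Shape 2
  odd  : ∀ t → Shape (3 + t * 2)
  even : ∀ t → Shape (4 + t * 2)

shape : ∀ n → 2 ≤ n → Shape n
shape (suc zero) (s≤s ())
shape (suc (suc zero)) _ = two
shape (suc (suc (suc zero))) _ = odd 0
shape (suc (suc (suc (suc n)))) _ with shape (suc (suc n)) (s≤s (s≤s z≤n))
... | two = even 0
... | odd t = odd (suc t)
... | even t = even (suc t)

open Invariants using (parity; quarter)

mainTheorem9 : (n : ℕ) → 2 ≤ n →
    Σ[ up ∈ Bool ] Σ[ k ∈ ℕ ] Σ[ f ∈ (Fin (2 * n) → Fin k) ]
      (IsRetractionMap (gon n) (fence (n ∸ 1) up) 2 f ×
       (n % 2 ≡ 1 → OrdIso (induced (gon n) f) chain2) ×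
       (n % 2 ≡ 0 →
         Σ[ k' ∈ ℕ ] Σ[ g ∈ (Fin k → Fin k') ]
           (IsRetractionMap (induced (gon n) f) point 2 g ×
            OrdIso (induced (induced (gon n) f) g) chain2)))
mainTheorem9 n 2≤n with shape n 2≤n
... | two = false , 2 , parity 2 , Square.first-retraction , (λ ()) ,
            λ _ → 2 , id , Square.second-retraction , Square.second-chain
... | odd t = false , 2 , parity (3 + t * 2) , OddPolygon.first-retraction t , (λ _ → OddPolygon.first-chain t) ,
              λ n%2≡0 → ⊥-elim (ℕ.1+n≢0 (trans (sym (OddPolygon.n%2≡1 t)) n%2≡0))
... | even t = false , 3 , quarter (4 + t * 2) , EvenPolygon.first-retraction t ,
               (λ n%2≡1 → ⊥-elim (ℕ.0≢1+n (trans (sym (EvenPolygon.n%2≡0 t)) n%2≡1))) ,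
               λ _ → 2 , collapse , EvenPolygon.second-retraction t , EvenPolygon.second-chain t
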